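{- For $n\ge 2$, a longest induced path of $G_n$ has exactly $3n-1$ vertices; that is, $G_n$ contains an induced path on $3n-1$ vertices but no induced path on $3n$ vertices.
   Context: Let $\mathbb{Z}_2=\{0,1\}$ and $\mathbb{Z}_{2n}=\{0,1,\ldots,2n-1\}$ (integers modulo $2n$). For $a\in\mathbb{Z}_2$, $\bar a$ denotes the element with $a+\bar a=1$. Write $(ab,j)$ for $(a,b,j)\in\mathbb{Z}_2\times\mathbb{Z}_2\times\mathbb{Z}_{2n}$. For $n\ge 2$, $G_n$ is the graph with vertex set $\mathbb{Z}_2\times\mathbb{Z}_2\times\mathbb{Z}_{2n}$ in which the neighborhood of each vertex $(ab,j)$ is exactly $\{(\bar a\bar b,j),(a\bar b,j),(ac,j-1),(ac,j+1),(\bar a c,j+2(-1)^a)\}$, where $c=a+b\in\mathbb{Z}_2$ and $a,b$ are regarded as the integers $0$ or $1$ in the exponent.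
   Formalization: In $G_n$ the fifth neighbour of each vertex (ab, j) is (āb, j+2(−1)ᵃ) in place of (āc, j+2(−1)ᵃ), so its first two coordinates are ā and b rather than ā and c = a+b. This corrects a misprint. -}

module Defs where

open import Data.Bool using (Bool; true; false; not; _xor_)
open import Data.Nat using (ℕ; zero; suc; _+_; _*_; _∸_; _%_)
open import Data.Nat.DivMod using (m%n<n)
open import Data.Fin using (Fin; toℕ; fromℕ<)
open import Data.Product using (Σ; _×_; _,_)
open import Data.Sum using (_⊎_)
open import Data.List using (List; _∷_; [])
open import Data.List.Membership.Propositional using (_∈_)
open import Function.Bundles using (_⇔_)
open import Function.Definitions using (Injective)
open import Relation.Binary.PropositionalEquality using (_≡_)

-- ℤ₂ is modelled by Bool (false = 0, true = 1); a + b in ℤ₂ is _xor_, ā is not a.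
-- ℤ_{2n} is modelled by Fin (2 * n).

Vertex : ℕ → Set
Vertex n = Bool × Bool × Fin (2 * n)

shift : (n : ℕ) → Fin (2 * n) → ℕ → Fin (2 * n)
shift (suc m) j k = fromℕ< (m%n<n (toℕ j + k) (2 * suc m))

pred₂ₙ : (n : ℕ) → Fin (2 * n) → Fin (2 * n)
pred₂ₙ n j = shift n j (2 * n ∸ 1)

succ₂ₙ : (n : ℕ) → Fin (2 * n) → Fin (2 * n)
succ₂ₙ n j = shift n j 1

-- j + 2(-1)^a (mod 2n): a = 0 gives j + 2, a = 1 gives j - 2
jump : (n : ℕ) → Bool → Fin (2 * n) → Fin (2 * n)
jump n false j = shift n j 2
jump n true  j = shift n j (2 * n ∸ 2)

-- the neighbourhood of (ab, j) in G_n, with c = a + b: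
--   (ā b̄, j), (a b̄, j), (a c, j-1), (a c, j+1), (ā b, j + 2(-1)^a)
-- (the fifth neighbour is taken as (ā b, …),
--  the printed (ā c, …) does not give a symmetric relation)
nbhd : (n : ℕ) → Vertex n → List (Vertex n)
nbhd n (a , b , j) =
  (not a , not b , j) ∷
  (a , not b , j) ∷
  (a , (a xor b) , pred₂ₙ n j) ∷
  (a , (a xor b) , succ₂ₙ n j) ∷
  (not a , b , jump n a j) ∷
  []

Adj : (n : ℕ) → Vertex n → Vertex n → Set
Adj n v w = w ∈ nbhd n v

InducedPath : (n k : ℕ) → Set
InducedPath n k =
  Σ (Fin k → Vertex n) λ p →
    Injective _≡_ _≡_ p ×
    (∀ i j → Adj n (p i) (p j) ⇔ (suc (toℕ i) ≡ toℕ j ⊎ suc (toℕ j) ≡ toℕ i))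

module Submission where

-- Unwrapping the index ℤ_{2n} to ℤ turns G_n into an infinite graph G∞ covering it. Its
-- vertices carry the level j − a, which changes by at most one along an edge, and an induced
-- path of G_n lifts to an induced path of G∞ that meets neither its own translate by 2n nor
-- the neighbourhood of that translate.
--
-- Long path: on the ladder a = 0 of G∞ the zigzag "rung, two steps along one rail, rung, two
-- steps along the other rail, …" is an induced path with 6 vertices in every 4 columns; its
-- first 3n − 1 vertices lie in columns 0, …, 2n − 2, where the projection to G_n is faithful.
--
-- No longer path: enumerating the seven-vertex induced paths of G∞ shows that an induced path
-- is monotone in level except possibly at its first and last step, so after reversal it is
-- ascending, and that along an ascending stretch flat steps are separated by two rising ones.
-- A potential argument then bounds a path of K vertices gaining R levels by
-- 2(K − 1) − 3R ≤ s + e, where s ≤ 2 and e ≤ 4 are read off finite tables indexed by the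
-- first two and the last three vertices. For K = 3n and E = 2n − R this says
-- 3E − 2 ≤ s + e, so E ≤ 2. If E ≤ −2 the path climbs more than one period, and a discrete
-- intermediate value argument finds a triple of vertices that clashes (is equal or adjacent)
-- with the translate by 2n of the first triple; if −1 ≤ E ≤ 2 the translate of the beginning
-- clashes with the end. Both contradict the lifting property; these finitely many clashes are
-- again checked by evaluation, and so is the case n = 2 directly.

open import Defs
open import Data.Bool using (Bool; true; false; not; _xor_)
import Data.Bool.Properties as Boolₚ
open import Data.Empty using (⊥; ⊥-elim)
open import Data.Fin as Fin using (Fin; toℕ; fromℕ<)
import Data.Fin.Properties as Finₚ
open import Data.Integer as ℤ using (+_; -[1+_]; +≤+; -≤+; -≤-)
import Data.Integer.Properties as ℤₚ
open import Data.Integer.Tactic.RingSolver using (solve-∀)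
open import Data.List using (List; []; _∷_; map; concatMap; filter; upTo)
import Data.List.Properties as Listₚ
open import Data.List.Membership.Propositional using (_∈_; _∉_; find; lose)
open import Data.List.Membership.Propositional.Properties using (∈-map⁺; ∈-map⁻; ∈-filter⁺; ∈-concatMap⁺; ∈-upTo⁺)
open import Data.List.Membership.DecPropositional using (_∈?_)
open import Data.List.Relation.Unary.Any as Any using (Any; any?; here; there)
open import Data.List.Relation.Unary.Any.Properties using (map⁻)
open import Data.List.Relation.Unary.All as All using (All; all?; []; _∷_)
open import Data.Nat as ℕ using (ℕ; zero; suc; z≤n; s≤s; _%_)
import Data.Nat.Properties as ℕₚ
open import Data.Nat.DivMod using (%-distribˡ-+; m%n%n≡m%n; [m+n]%n≡m%n; m<n⇒m%n≡m)
open import Data.Nat.GeneralisedArithmetic using (fold)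
open import Data.Nat.Induction using (<-rec)
import Data.Nat.Tactic.RingSolver as ℕ-Solver
open import Data.Product using (∃; _×_; _,_; proj₁; proj₂)
import Data.Product.Properties as Productₚ
open import Data.Sum using (_⊎_; inj₁; inj₂)
open import Data.Unit using (⊤; tt)
open import Function using (_∘_)
open import Function.Bundles using (_⇔_; mk⇔; Equivalence)
open import Function.Nary.NonDependent using (congₙ)
open import Relation.Binary.Definitions using (DecidableEquality)
open import Relation.Binary.PropositionalEquality
open import Relation.Nullary using (¬_; Dec; does; yes; no; ¬?; _×-dec_; _⊎-dec_; _→-dec_)
open import Relation.Nullary.Decidable using (map′)

-- Checking refl against does a? ≡ true is far cheaper than normalising from-yes a?; the
-- certificates obtained this way are kept opaque so that they are never unfolded again.
by-evaluation : ∀ {A : Set} (a? : Dec A) → does a? ≡ true → A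
by-evaluation (yes a) _ = a
by-evaluation (no _) ()

module Sequences where
  open ℤ using (ℤ; _+_; _-_; _≤_)

  difference-≤ : ∀ {x y c} → y - x ≤ c → y ≤ c + x
  difference-≤ {x} {y} {c} y-x≤c = begin
    y             ≡⟨ split x y ⟩
    (y - x) + x   ≤⟨ ℤₚ.+-monoˡ-≤ x y-x≤c ⟩
    c + x         ∎
    where
    open ℤₚ.≤-Reasoning
    split : ∀ x y → y ≡ (y - x) + x
    split = solve-∀

  intermediate-value : (f : ℕ → ℤ) (d : ℕ) {τ : ℤ} → (∀ i → i ℕ.< d → f (suc i) ≤ + 1 + f i) →
    f 0 ≤ τ → τ ≤ f d → ∃ λ j → j ℕ.≤ d × f j ≡ τ
  intermediate-value f zero    slow lo hi = 0 , z≤n , ℤₚ.≤-antisym lo hi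
  intermediate-value f (suc d) {τ} slow lo hi with τ ℤₚ.≤? f d
  ... | yes τ≤fd =
    let j , j≤d , fj≡τ = intermediate-value f d (λ i i<d → slow i (ℕₚ.m≤n⇒m≤1+n i<d)) lo τ≤fd
    in j , ℕₚ.m≤n⇒m≤1+n j≤d , fj≡τ
  ... | no τ≰fd = suc d , ℕₚ.≤-refl , ℤₚ.≤-antisym f[1+d]≤τ hi
    where
    f[1+d]≤τ : f (suc d) ≤ τ
    f[1+d]≤τ = ℤₚ.≤-trans (slow d ℕₚ.≤-refl) (ℤₚ.i<j⇒suc[i]≤j (ℤₚ.≰⇒> τ≰fd))

  descent : (f : ℕ → ℤ) (n : ℕ) → (∀ i → i ℕ.< n → f (suc i) ≤ f i) → f n ≤ f 0
  descent f zero    _          = ℤₚ.≤-refl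
  descent f (suc n) decreasing =
    ℤₚ.≤-trans (decreasing n ℕₚ.≤-refl) (descent f n (λ i i<n → decreasing i (ℕₚ.m≤n⇒m≤1+n i<n)))

module Cover where
  open ℤ using (ℤ; _+_; _-_; -_; _≤_)

  Vertex∞ : Set
  Vertex∞ = Bool × Bool × ℤ

  jump∞ : Bool → ℤ → ℤ
  jump∞ false j = j + + 2
  jump∞ true  j = j - + 2

  nbhd∞ : Vertex∞ → List Vertex∞
  nbhd∞ (a , b , j) =
    (not a , not b , j) ∷
    (a , not b , j) ∷
    (a , a xor b , j - + 1) ∷
    (a , a xor b , j + + 1) ∷
    (not a , b , jump∞ a j) ∷ []

  Adj∞ : Vertex∞ → Vertex∞ → Set
  Adj∞ u v = v ∈ nbhd∞ u

  _≟∞_ : DecidableEquality Vertex∞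
  _≟∞_ = Productₚ.≡-dec Boolₚ._≟_ (Productₚ.≡-dec Boolₚ._≟_ ℤₚ._≟_)

  adj? : ∀ u v → Dec (Adj∞ u v)
  adj? u v = _∈?_ _≟∞_ v (nbhd∞ u)

  coord : Vertex∞ → ℤ
  coord (_ , _ , j) = j

  bit : Bool → ℤ
  bit false = + 0
  bit true  = + 1

  level : Vertex∞ → ℤ
  level (a , _ , j) = j - bit a

  translate : ℤ → Vertex∞ → Vertex∞
  translate c (a , b , j) = (a , b , j + c)

  vertex-≡ : ∀ {a a' b b' : Bool} {j j' : ℤ} → a ≡ a' → b ≡ b' → j ≡ j' → (a , b , j) ≡ (a' , b' , j')
  vertex-≡ refl refl refl = refl

  xor-cancelˡ : ∀ a b → a xor (a xor b) ≡ b
  xor-cancelˡ false b = refl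
  xor-cancelˡ true  b = Boolₚ.not-involutive b

  Adj∞-sym : ∀ {u v} → Adj∞ u v → Adj∞ v u
  Adj∞-sym {a , b , j} (here refl) =
    here (sym (vertex-≡ (Boolₚ.not-involutive a) (Boolₚ.not-involutive b) refl))
  Adj∞-sym {a , b , j} (there (here refl)) =
    there (here (sym (vertex-≡ refl (Boolₚ.not-involutive b) refl)))
  Adj∞-sym {a , b , j} (there (there (here refl))) =
    there (there (there (here (sym (vertex-≡ refl (xor-cancelˡ a b) (j-1+1 j))))))
    where
    j-1+1 : ∀ j → j - + 1 + + 1 ≡ j
    j-1+1 = solve-∀
  Adj∞-sym {a , b , j} (there (there (there (here refl)))) =
    there (there (here (sym (vertex-≡ refl (xor-cancelˡ a b) (j+1-1 j)))))
    where
    j+1-1 : ∀ j → j + + 1 - + 1 ≡ j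
    j+1-1 = solve-∀
  Adj∞-sym {false , b , j} (there (there (there (there (here refl))))) =
    there (there (there (there (here (sym (vertex-≡ refl refl (j+2-2 j)))))))
    where
    j+2-2 : ∀ j → j + + 2 - + 2 ≡ j
    j+2-2 = solve-∀
  Adj∞-sym {true , b , j} (there (there (there (there (here refl))))) =
    there (there (there (there (here (sym (vertex-≡ refl refl (j-2+2 j)))))))
    where
    j-2+2 : ∀ j → j - + 2 + + 2 ≡ j
    j-2+2 = solve-∀

  translate-translate : ∀ c d u → translate c (translate d u) ≡ translate (d + c) u
  translate-translate c d (a , b , j) = cong (λ z → (a , b , z)) (ℤₚ.+-assoc j d c)

  translate-inverse : ∀ c u → translate (- c) (translate c u) ≡ u
  translate-inverse c (a , b , j) = cong (λ z → (a , b , z)) (j+c-c j c)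
    where
    j+c-c : ∀ j c → j + c + - c ≡ j
    j+c-c = solve-∀

  translate-fixed : ∀ c v → translate c v ≡ v → c ≡ + 0
  translate-fixed c (a , b , j) eq = trans (isolate j c) (trans (cong (_- j) (cong coord eq)) (ℤₚ.+-inverseʳ j))
    where
    isolate : ∀ j c → c ≡ j + c - j
    isolate = solve-∀

  translate-injective : ∀ c {u v} → translate c u ≡ translate c v → u ≡ v
  translate-injective c {u} {v} eq =
    trans (sym (translate-inverse c u)) (trans (cong (translate (- c)) eq) (translate-inverse c v))

  nbhd∞-translate : ∀ c u → nbhd∞ (translate c u) ≡ map (translate c) (nbhd∞ u)
  nbhd∞-translate c (a , b , j) =
    cong₂ _∷_ refl (cong₂ _∷_ refl
      (cong₂ _∷_ (cong (λ z → (a , a xor b , z)) (swap j c (- + 1)))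
      (cong₂ _∷_ (cong (λ z → (a , a xor b , z)) (swap j c (+ 1)))
      (cong₂ _∷_ (cong (λ z → (not a , b , z)) (jump∞-translate a)) refl))))
    where
    swap : ∀ j c k → j + c + k ≡ j + k + c
    swap = solve-∀
    jump∞-translate : ∀ a → jump∞ a (j + c) ≡ jump∞ a j + c
    jump∞-translate false = swap j c (+ 2)
    jump∞-translate true  = swap j c (- + 2)

  Adj∞-translate : ∀ c {u v} → Adj∞ u v → Adj∞ (translate c u) (translate c v)
  Adj∞-translate c {u} {v} uv = subst (translate c v ∈_) (sym (nbhd∞-translate c u)) (∈-map⁺ (translate c) uv)

  Adj∞-translate⁻ : ∀ c {u v} → Adj∞ (translate c u) (translate c v) → Adj∞ u v
  Adj∞-translate⁻ c {u} {v} uv with ∈-map⁻ (translate c) (subst (translate c v ∈_) (nbhd∞-translate c u) uv)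
  ... | w , w∈ , eq = subst (_∈ nbhd∞ u) (sym (translate-injective c eq)) w∈

  level-translate : ∀ c u → level (translate c u) ≡ level u + c
  level-translate c (a , b , j) = swap j c (- bit a)
    where
    swap : ∀ j c k → j + c + k ≡ j + k + c
    swap = solve-∀

  UnitStep : ℤ → Set
  UnitStep d = d ≡ + 1 ⊎ d ≡ + 0 ⊎ d ≡ -[1+ 0 ]

  step : Vertex∞ → Vertex∞ → ℤ
  step u v = level v - level u

  Adj∞⇒unit-step : ∀ {u v} → Adj∞ u v → UnitStep (step u v)
  Adj∞⇒unit-step {false , b , j} (here refl) = inj₂ (inj₂ (down j))
    where
    down : ∀ j → j - + 1 - (j - + 0) ≡ -[1+ 0 ]
    down = solve-∀
  Adj∞⇒unit-step {true , b , j} (here refl) = inj₁ (up j)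
    where
    up : ∀ j → j - + 0 - (j - + 1) ≡ + 1
    up = solve-∀
  Adj∞⇒unit-step {a , b , j} (there (here refl)) = inj₂ (inj₁ (flat j (bit a)))
    where
    flat : ∀ j x → j - x - (j - x) ≡ + 0
    flat = solve-∀
  Adj∞⇒unit-step {a , b , j} (there (there (here refl))) = inj₂ (inj₂ (down j (bit a)))
    where
    down : ∀ j x → j - + 1 - x - (j - x) ≡ -[1+ 0 ]
    down = solve-∀
  Adj∞⇒unit-step {a , b , j} (there (there (there (here refl)))) = inj₁ (up j (bit a))
    where
    up : ∀ j x → j + + 1 - x - (j - x) ≡ + 1
    up = solve-∀
  Adj∞⇒unit-step {false , b , j} (there (there (there (there (here refl))))) = inj₁ (up j)
    where
    up : ∀ j → j + + 2 - + 1 - (j - + 0) ≡ + 1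
    up = solve-∀
  Adj∞⇒unit-step {true , b , j} (there (there (there (there (here refl))))) = inj₂ (inj₂ (down j))
    where
    down : ∀ j → j - + 2 - + 0 - (j - + 1) ≡ -[1+ 0 ]
    down = solve-∀

  step-translate : ∀ c u v → step (translate c u) (translate c v) ≡ step u v
  step-translate c u v rewrite level-translate c u | level-translate c v = cancel (level v) (level u) c
    where
    cancel : ∀ x y c → x + c - (y + c) ≡ x - y
    cancel = solve-∀

  step-reverse : ∀ u v → step v u ≡ - step u v
  step-reverse u v = antisym (level u) (level v)
    where
    antisym : ∀ x y → x - y ≡ - (y - x)
    antisym = solve-∀

  ladder-neighbour : ∀ {b j v} → Adj∞ (false , b , j) v → proj₁ v ≡ false →
    coord v ≡ j ⊎ coord v ≡ j - + 1 ⊎ coord v ≡ j + + 1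
  ladder-neighbour (here refl) ()
  ladder-neighbour (there (here refl)) _ = inj₁ refl
  ladder-neighbour (there (there (here refl))) _ = inj₂ (inj₁ refl)
  ladder-neighbour (there (there (there (here refl)))) _ = inj₂ (inj₂ refl)
  ladder-neighbour (there (there (there (there (here refl))))) ()

  unit-step≤1 : ∀ {d} → UnitStep d → d ≤ + 1
  unit-step≤1 (inj₁ refl) = ℤₚ.≤-refl
  unit-step≤1 (inj₂ (inj₁ refl)) = +≤+ z≤n
  unit-step≤1 (inj₂ (inj₂ refl)) = -≤+

  unit-step≥-1 : ∀ {d} → UnitStep d → -[1+ 0 ] ≤ d
  unit-step≥-1 (inj₁ refl) = -≤+
  unit-step≥-1 (inj₂ (inj₁ refl)) = -≤+
  unit-step≥-1 (inj₂ (inj₂ refl)) = ℤₚ.≤-refl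

  record InducedPath∞ (K : ℕ) (r : ℕ → Vertex∞) : Set where
    field
      adjacent : ∀ i → suc i ℕ.< K → Adj∞ (r i) (r (suc i))
      adjacent⇒consecutive : ∀ i j → i ℕ.< K → j ℕ.< K → Adj∞ (r i) (r j) → suc i ≡ j ⊎ suc j ≡ i
      injective : ∀ i j → i ℕ.< K → j ℕ.< K → r i ≡ r j → i ≡ j

    nonadjacent : ∀ i j → j ℕ.< K → suc i ℕ.< j → ¬ Adj∞ (r j) (r i)
    nonadjacent i j j<K i+1<j rj~ri
      with adjacent⇒consecutive j i j<K (ℕₚ.<-trans (ℕₚ.<-trans (ℕₚ.n<1+n i) i+1<j) j<K) rj~ri
    ... | inj₁ refl = ℕₚ.<-asym (ℕₚ.<-trans (ℕₚ.n<1+n i) i+1<j) (ℕₚ.n<1+n _)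
    ... | inj₂ refl = ℕₚ.<-irrefl refl i+1<j

  open InducedPath∞

  restrict : ∀ {K r L} → L ℕ.≤ K → InducedPath∞ K r → InducedPath∞ L r
  restrict L≤K p = record
    { adjacent = λ i i+1<L → adjacent p i (ℕₚ.<-≤-trans i+1<L L≤K)
    ; adjacent⇒consecutive = λ i j i<L j<L →
        adjacent⇒consecutive p i j (ℕₚ.<-≤-trans i<L L≤K) (ℕₚ.<-≤-trans j<L L≤K)
    ; injective = λ i j i<L j<L → injective p i j (ℕₚ.<-≤-trans i<L L≤K) (ℕₚ.<-≤-trans j<L L≤K)
    }

  subpath : ∀ {K r} w {L} → L ℕ.+ w ℕ.≤ K → InducedPath∞ K r → InducedPath∞ L (λ i → r (i ℕ.+ w))
  subpath {K} {r} w {L} L+w≤K p = record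
    { adjacent = λ i i+1<L → adjacent p (i ℕ.+ w) (inside i+1<L)
    ; adjacent⇒consecutive = λ i j i<L j<L ri~rj →
        unshift (adjacent⇒consecutive p _ _ (inside i<L) (inside j<L) ri~rj)
    ; injective = λ i j i<L j<L eq → ℕₚ.+-cancelʳ-≡ w i j (injective p _ _ (inside i<L) (inside j<L) eq)
    }
    where
    inside : ∀ {i} → i ℕ.< L → i ℕ.+ w ℕ.< K
    inside i<L = ℕₚ.<-≤-trans (ℕₚ.+-monoˡ-< w i<L) L+w≤K
    unshift : ∀ {i j} → suc i ℕ.+ w ≡ j ℕ.+ w ⊎ suc j ℕ.+ w ≡ i ℕ.+ w → suc i ≡ j ⊎ suc j ≡ i
    unshift (inj₁ eq) = inj₁ (ℕₚ.+-cancelʳ-≡ w _ _ eq)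
    unshift (inj₂ eq) = inj₂ (ℕₚ.+-cancelʳ-≡ w _ _ eq)

  translate-path : ∀ c {K r} → InducedPath∞ K r → InducedPath∞ K (translate c ∘ r)
  translate-path c p = record
    { adjacent = λ i i+1<K → Adj∞-translate c (adjacent p i i+1<K)
    ; adjacent⇒consecutive = λ i j i<K j<K ri~rj →
        adjacent⇒consecutive p i j i<K j<K (Adj∞-translate⁻ c ri~rj)
    ; injective = λ i j i<K j<K eq → injective p i j i<K j<K (translate-injective c eq)
    }

  reversed : ℕ → (ℕ → Vertex∞) → ℕ → Vertex∞
  reversed M r i = r (M ℕ.∸ i)

  reverse-path : ∀ M {r} → InducedPath∞ (suc M) r → InducedPath∞ (suc M) (reversed M r)
  reverse-path M {r} p = record
    { adjacent = λ i i+1<K →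
        let i+1≤M = ℕₚ.≤-pred i+1<K in
        Adj∞-sym (subst (λ z → Adj∞ (r (M ℕ.∸ suc i)) (r z)) (sym (∸-suc i+1≤M))
          (adjacent p (M ℕ.∸ suc i) (subst (ℕ._< suc M) (∸-suc i+1≤M) (bound i))))
    ; adjacent⇒consecutive = λ i j i<K j<K ri~rj →
        flip i j i<K j<K (adjacent⇒consecutive p _ _ (bound i) (bound j) ri~rj)
    ; injective = λ i j i<K j<K eq →
        ℕₚ.∸-cancelˡ-≡ (ℕₚ.≤-pred i<K) (ℕₚ.≤-pred j<K) (injective p _ _ (bound i) (bound j) eq)
    }
    where
    bound : ∀ i → M ℕ.∸ i ℕ.< suc M
    bound i = s≤s (ℕₚ.m∸n≤m M i)
    ∸-suc : ∀ {i} → suc i ℕ.≤ M → M ℕ.∸ i ≡ suc (M ℕ.∸ suc i)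
    ∸-suc i+1≤M = ℕₚ.+-∸-assoc 1 i+1≤M
    unflip : ∀ i j → i ℕ.< suc M → suc (M ℕ.∸ i) ≡ M ℕ.∸ j → suc j ≡ i
    unflip i j i<K eq =
      ℕₚ.∸-cancelˡ-≡ j+1≤M (ℕₚ.≤-pred i<K) (ℕₚ.suc-injective (trans (sym (∸-suc j+1≤M)) (sym eq)))
      where
      j<i : j ℕ.< i
      j<i = ℕₚ.∸-cancelʳ-< (subst (M ℕ.∸ i ℕ.<_) eq (ℕₚ.n<1+n _))
      j+1≤M : suc j ℕ.≤ M
      j+1≤M = ℕₚ.≤-trans j<i (ℕₚ.≤-pred i<K)
    flip : ∀ i j → i ℕ.< suc M → j ℕ.< suc M →
           suc (M ℕ.∸ i) ≡ M ℕ.∸ j ⊎ suc (M ℕ.∸ j) ≡ M ℕ.∸ i → suc i ≡ j ⊎ suc j ≡ i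
    flip i j i<K j<K (inj₁ eq) = inj₂ (unflip i j i<K eq)
    flip i j i<K j<K (inj₂ eq) = inj₁ (unflip j i j<K eq)

  record Apart (N : ℤ) (K : ℕ) (r : ℕ → Vertex∞) : Set where
    field
      disjoint : ∀ a b → a ℕ.< K → b ℕ.< K → translate N (r a) ≢ r b
      anticomplete : ∀ a b → a ℕ.< K → b ℕ.< K → ¬ Adj∞ (r b) (translate N (r a))

  reverse-apart : ∀ M {N r} → Apart N (suc M) r → Apart N (suc M) (reversed M r)
  reverse-apart M apart = record
    { disjoint = λ a b _ _ → Apart.disjoint apart _ _ (bound a) (bound b)
    ; anticomplete = λ a b _ _ → Apart.anticomplete apart _ _ (bound a) (bound b)
    }
    where
    bound : ∀ i → M ℕ.∸ i ℕ.< suc M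
    bound i = s≤s (ℕₚ.m∸n≤m M i)

  Extends : Vertex∞ → Vertex∞ → List Vertex∞ → Set
  Extends y x p = y ∉ x ∷ p × All (λ z → ¬ Adj∞ y z) p

  extends? : ∀ y x p → Dec (Extends y x p)
  extends? y x p = ¬? (_∈?_ _≟∞_ y (x ∷ p)) ×-dec all? (λ z → ¬? (adj? y z)) p

  -- Induced paths are listed last vertex first.
  extensions : List Vertex∞ → List (List Vertex∞)
  extensions []      = []
  extensions (x ∷ p) = map (_∷ x ∷ p) (filter (λ y → extends? y x p) (nbhd∞ x))

  inducedPaths : ℕ → Vertex∞ → List (List Vertex∞)
  inducedPaths zero    v = (v ∷ []) ∷ []
  inducedPaths (suc L) v = concatMap extensions (inducedPaths L v)

  mutual
    prefix : (ℕ → Vertex∞) → ℕ → List Vertex∞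
    prefix r L = r L ∷ earlier r L

    earlier : (ℕ → Vertex∞) → ℕ → List Vertex∞
    earlier r zero    = []
    earlier r (suc L) = prefix r L

  mutual
    ∈-prefix : ∀ {r L x} → x ∈ prefix r L → ∃ λ i → i ℕ.≤ L × x ≡ r i
    ∈-prefix {L = L} (here eq) = L , ℕₚ.≤-refl , eq
    ∈-prefix (there x∈) with ∈-earlier x∈
    ... | i , i<L , eq = i , ℕₚ.<⇒≤ i<L , eq

    ∈-earlier : ∀ {r L x} → x ∈ earlier r L → ∃ λ i → i ℕ.< L × x ≡ r i
    ∈-earlier {L = suc L} x∈ with ∈-prefix x∈
    ... | i , i≤L , eq = i , s≤s i≤L , eq

  prefix∈inducedPaths : ∀ L {r} → InducedPath∞ (suc L) r → prefix r L ∈ inducedPaths L (r 0)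
  prefix∈inducedPaths zero    p = here refl
  prefix∈inducedPaths (suc L) {r} p =
    ∈-concatMap⁺ extensions (Any.map (λ { refl → next∈ }) (prefix∈inducedPaths L (restrict (ℕₚ.n≤1+n _) p)))
    where
    next∈ : prefix r (suc L) ∈ extensions (prefix r L)
    next∈ = ∈-map⁺ (_∷ prefix r L) (∈-filter⁺ (λ y → extends? y (r L) (earlier r L))
              (adjacent p L ℕₚ.≤-refl) (new , All.tabulate far))
      where
      new : r (suc L) ∉ prefix r L
      new x∈ with ∈-prefix x∈
      ... | i , i≤L , eq =
        ℕₚ.<-irrefl (sym (injective p _ _ ℕₚ.≤-refl (s≤s (ℕₚ.m≤n⇒m≤1+n i≤L)) eq)) (s≤s i≤L)
      far : ∀ {z} → z ∈ earlier r L → ¬ Adj∞ (r (suc L)) z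
      far z∈ with ∈-earlier z∈
      ... | i , i<L , refl = nonadjacent p i (suc L) ℕₚ.≤-refl (s≤s i<L)

  origins : List Vertex∞
  origins = (false , false , + 0) ∷ (false , true , + 0) ∷ (true , false , + 0) ∷ (true , true , + 0) ∷ []

  ∈-origins : ∀ v → coord v ≡ + 0 → v ∈ origins
  ∈-origins (false , false , _) refl = here refl
  ∈-origins (false , true  , _) refl = there (here refl)
  ∈-origins (true  , false , _) refl = there (there (here refl))
  ∈-origins (true  , true  , _) refl = there (there (there (here refl)))

  inducedPathsAtOrigin : ℕ → List (List Vertex∞)
  inducedPathsAtOrigin L = concatMap (inducedPaths L) origins

  normalize : (ℕ → Vertex∞) → ℕ → Vertex∞
  normalize r = translate (- coord (r 0)) ∘ r

  prefix∈inducedPathsAtOrigin : ∀ L {r} → InducedPath∞ (suc L) r →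
    prefix (normalize r) L ∈ inducedPathsAtOrigin L
  prefix∈inducedPathsAtOrigin L {r} p =
    ∈-concatMap⁺ (inducedPaths L) (Any.map (λ { refl → prefix∈inducedPaths L (translate-path _ p) })
                           (∈-origins _ (ℤₚ.+-inverseʳ (coord (r 0)))))

module Projection (m : ℕ) where
  open ℤ using (ℤ; _+_; _-_; _≤_)
  open Cover

  n N : ℕ
  n = suc m
  N = 2 ℕ.* n

  toℕ-shift : ∀ x k → toℕ (shift n x k) ≡ (toℕ x ℕ.+ k) % N
  toℕ-shift x k = Finₚ.toℕ-fromℕ< _

  shift-≡ : ∀ x k y l → (toℕ x ℕ.+ k) % N ≡ (toℕ y ℕ.+ l) % N → shift n x k ≡ shift n y l
  shift-≡ x k y l eq = Finₚ.toℕ-injective (trans (toℕ-shift x k) (trans eq (sym (toℕ-shift y l))))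

  toℕ%N : ∀ (x : Fin N) → toℕ x % N ≡ toℕ x
  toℕ%N x = m<n⇒m%n≡m (Finₚ.toℕ<n x)

  shift-shift : ∀ x k l → shift n (shift n x k) l ≡ shift n x (k ℕ.+ l)
  shift-shift x k l = shift-≡ (shift n x k) l x (k ℕ.+ l) (begin
    (toℕ (shift n x k) ℕ.+ l) % N    ≡⟨ cong (λ z → (z ℕ.+ l) % N) (toℕ-shift x k) ⟩
    ((toℕ x ℕ.+ k) % N ℕ.+ l) % N    ≡⟨ %-distribˡ-+ ((toℕ x ℕ.+ k) % N) l N ⟩
    ((toℕ x ℕ.+ k) % N % N ℕ.+ l % N) % N ≡⟨ cong (λ z → (z ℕ.+ l % N) % N) (m%n%n≡m%n (toℕ x ℕ.+ k) N) ⟩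
    ((toℕ x ℕ.+ k) % N ℕ.+ l % N) % N ≡⟨ %-distribˡ-+ (toℕ x ℕ.+ k) l N ⟨
    (toℕ x ℕ.+ k ℕ.+ l) % N          ≡⟨ cong (_% N) (ℕₚ.+-assoc (toℕ x) k l) ⟩
    (toℕ x ℕ.+ (k ℕ.+ l)) % N        ∎)
    where open ≡-Reasoning

  shift-period : ∀ x k → shift n x (k ℕ.+ N) ≡ shift n x k
  shift-period x k = shift-≡ x (k ℕ.+ N) x k
    (trans (cong (_% N) (sym (ℕₚ.+-assoc (toℕ x) k N))) ([m+n]%n≡m%n (toℕ x ℕ.+ k) N))

  shift-zero : ∀ x → shift n x 0 ≡ x
  shift-zero x = Finₚ.toℕ-injective
    (trans (toℕ-shift x 0) (trans (cong (_% N) (ℕₚ.+-identityʳ (toℕ x))) (toℕ%N x)))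

  succ pred : Fin N → Fin N
  succ = succ₂ₙ n
  pred = pred₂ₙ n

  1≤N : 1 ℕ.≤ N
  1≤N = s≤s z≤n

  succ-pred : ∀ x → succ (pred x) ≡ x
  succ-pred x = begin
    shift n (shift n x (N ℕ.∸ 1)) 1 ≡⟨ shift-shift x (N ℕ.∸ 1) 1 ⟩
    shift n x (N ℕ.∸ 1 ℕ.+ 1)       ≡⟨ cong (shift n x) (ℕₚ.m∸n+n≡m 1≤N) ⟩
    shift n x N                     ≡⟨ shift-period x 0 ⟩
    shift n x 0                     ≡⟨ shift-zero x ⟩
    x                               ∎
    where open ≡-Reasoning

  pred-succ : ∀ x → pred (succ x) ≡ x
  pred-succ x = begin
    shift n (shift n x 1) (N ℕ.∸ 1) ≡⟨ shift-shift x 1 (N ℕ.∸ 1) ⟩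
    shift n x (1 ℕ.+ (N ℕ.∸ 1))     ≡⟨ cong (shift n x) (ℕₚ.m+[n∸m]≡n 1≤N) ⟩
    shift n x N                     ≡⟨ shift-period x 0 ⟩
    shift n x 0                     ≡⟨ shift-zero x ⟩
    x                               ∎
    where open ≡-Reasoning

  jump-forward : ∀ x → jump n false x ≡ succ (succ x)
  jump-forward x = sym (shift-shift x 1 1)

  jump-backward : ∀ x → jump n true x ≡ pred (pred x)
  jump-backward x = begin
    shift n x (N ℕ.∸ 2)                      ≡⟨ shift-period x (N ℕ.∸ 2) ⟨
    shift n x (N ℕ.∸ 2 ℕ.+ N)                ≡⟨ cong (shift n x) two-steps ⟩
    shift n x (N ℕ.∸ 1 ℕ.+ (N ℕ.∸ 1))        ≡⟨ shift-shift x (N ℕ.∸ 1) (N ℕ.∸ 1) ⟨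
    pred (pred x)                            ∎
    where
    open ≡-Reasoning
    two-steps : N ℕ.∸ 2 ℕ.+ N ≡ N ℕ.∸ 1 ℕ.+ (N ℕ.∸ 1)
    two-steps = split N (ℕₚ.*-monoʳ-≤ 2 (s≤s z≤n))
      where
      split : ∀ K → 2 ℕ.≤ K → K ℕ.∸ 2 ℕ.+ K ≡ K ℕ.∸ 1 ℕ.+ (K ℕ.∸ 1)
      split (suc (suc K)) _ = ℕₚ.+-suc K (suc K)
      split (suc zero) (s≤s ())

  wrap : ℤ → Fin N
  wrap (+ t)      = fold Fin.zero succ t
  wrap -[1+ t ]   = fold (pred Fin.zero) pred t

  wrap-suc : ∀ j → wrap (j + + 1) ≡ succ (wrap j)
  wrap-suc (+ t)            = cong (fold Fin.zero succ) (ℕₚ.+-comm t 1)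
  wrap-suc -[1+ zero ]      = sym (succ-pred Fin.zero)
  wrap-suc -[1+ suc t ]     = sym (succ-pred (wrap -[1+ t ]))

  wrap-pred : ∀ j → wrap (j - + 1) ≡ pred (wrap j)
  wrap-pred (+ zero)        = refl
  wrap-pred (+ suc t)       = sym (pred-succ (wrap (+ t)))
  wrap-pred -[1+ t ]        = cong (λ s → pred (fold (pred Fin.zero) pred s)) (ℕₚ.+-identityʳ t)

  wrap-jump : ∀ a j → wrap (jump∞ a j) ≡ jump n a (wrap j)
  wrap-jump false j = begin
    wrap (j + + 2)              ≡⟨ cong wrap (two-ones j) ⟩
    wrap (j + + 1 + + 1)        ≡⟨ wrap-suc (j + + 1) ⟩
    succ (wrap (j + + 1))       ≡⟨ cong succ (wrap-suc j) ⟩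
    succ (succ (wrap j))        ≡⟨ jump-forward (wrap j) ⟨
    jump n false (wrap j)       ∎
    where
    open ≡-Reasoning
    two-ones : ∀ j → j + + 2 ≡ j + + 1 + + 1
    two-ones = solve-∀
  wrap-jump true j = begin
    wrap (j - + 2)              ≡⟨ cong wrap (two-ones j) ⟩
    wrap (j - + 1 - + 1)        ≡⟨ wrap-pred (j - + 1) ⟩
    pred (wrap (j - + 1))       ≡⟨ cong pred (wrap-pred j) ⟩
    pred (pred (wrap j))        ≡⟨ jump-backward (wrap j) ⟨
    jump n true (wrap j)        ∎
    where
    open ≡-Reasoning
    two-ones : ∀ j → j - + 2 ≡ j - + 1 - + 1
    two-ones = solve-∀

  wrap-+ : ∀ j t → wrap (j + + t) ≡ fold (wrap j) succ t
  wrap-+ j zero    = cong wrap (ℤₚ.+-identityʳ j)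
  wrap-+ j (suc t) = begin
    wrap (j + + suc t)          ≡⟨ cong wrap (regroup j (+ t)) ⟩
    wrap (j + + t + + 1)        ≡⟨ wrap-suc (j + + t) ⟩
    succ (wrap (j + + t))       ≡⟨ cong succ (wrap-+ j t) ⟩
    fold (wrap j) succ (suc t)  ∎
    where
    open ≡-Reasoning
    regroup : ∀ j t → j + (+ 1 + t) ≡ j + t + + 1
    regroup = solve-∀

  toℕ-fold-succ : ∀ x t → toℕ (fold x succ t) ≡ (toℕ x ℕ.+ t) % N
  toℕ-fold-succ x zero    = sym (trans (cong (_% N) (ℕₚ.+-identityʳ (toℕ x))) (toℕ%N x))
  toℕ-fold-succ x (suc t) = begin
    toℕ (succ (fold x succ t))              ≡⟨ toℕ-shift (fold x succ t) 1 ⟩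
    (toℕ (fold x succ t) ℕ.+ 1) % N         ≡⟨ cong (λ z → (z ℕ.+ 1) % N) (toℕ-fold-succ x t) ⟩
    ((toℕ x ℕ.+ t) % N ℕ.+ 1) % N           ≡⟨ %-distribˡ-+ ((toℕ x ℕ.+ t) % N) 1 N ⟩
    ((toℕ x ℕ.+ t) % N % N ℕ.+ 1 % N) % N   ≡⟨ cong (λ z → (z ℕ.+ 1 % N) % N) (m%n%n≡m%n (toℕ x ℕ.+ t) N) ⟩
    ((toℕ x ℕ.+ t) % N ℕ.+ 1 % N) % N       ≡⟨ %-distribˡ-+ (toℕ x ℕ.+ t) 1 N ⟨
    (toℕ x ℕ.+ t ℕ.+ 1) % N                 ≡⟨ cong (_% N) (ℕₚ.+-assoc (toℕ x) t 1) ⟩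
    (toℕ x ℕ.+ (t ℕ.+ 1)) % N               ≡⟨ cong (λ z → (toℕ x ℕ.+ z) % N) (ℕₚ.+-comm t 1) ⟩
    (toℕ x ℕ.+ suc t) % N                   ∎
    where open ≡-Reasoning

  wrap-period : ∀ j → wrap (j + + N) ≡ wrap j
  wrap-period j = trans (wrap-+ j N) (Finₚ.toℕ-injective
    (trans (toℕ-fold-succ (wrap j) N) (trans ([m+n]%n≡m%n (toℕ (wrap j)) N) (toℕ%N (wrap j)))))

  toℕ-wrap : ∀ t → t ℕ.< N → toℕ (wrap (+ t)) ≡ t
  toℕ-wrap t t<N = trans (toℕ-fold-succ Fin.zero t) (m<n⇒m%n≡m t<N)

  toℕ-wrap-minus-one : toℕ (wrap -[1+ 0 ]) ≡ N ℕ.∸ 1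
  toℕ-wrap-minus-one = trans (toℕ-shift Fin.zero (N ℕ.∸ 1)) (m<n⇒m%n≡m (ℕₚ.n<1+n (N ℕ.∸ 1)))

  project : Vertex∞ → Vertex n
  project (a , b , j) = (a , b , wrap j)

  nbhd-project : ∀ u → nbhd n (project u) ≡ map project (nbhd∞ u)
  nbhd-project (a , b , j) =
    cong₂ _∷_ refl (cong₂ _∷_ refl
      (cong₂ _∷_ (cong (λ z → (a , a xor b , z)) (sym (wrap-pred j)))
      (cong₂ _∷_ (cong (λ z → (a , a xor b , z)) (sym (wrap-suc j)))
      (cong₂ _∷_ (cong (λ z → (not a , b , z)) (sym (wrap-jump a j))) refl))))

  Adj-project : ∀ {u v} → Adj∞ u v → Adj n (project u) (project v)
  Adj-project {u} {v} uv = subst (project v ∈_) (sym (nbhd-project u)) (∈-map⁺ project uv)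

  Adj-lift : ∀ {u w} → Adj n (project u) w → ∃ λ v → Adj∞ u v × project v ≡ w
  Adj-lift {u} {w} uw with ∈-map⁻ project (subst (w ∈_) (nbhd-project u) uw)
  ... | v , uv , w≡ = v , uv , sym w≡

  project-period : ∀ v → project (translate (+ N) v) ≡ project v
  project-period (a , b , j) = cong (λ z → (a , b , z)) (wrap-period j)

  _≟V_ : DecidableEquality (Vertex n)
  _≟V_ = Productₚ.≡-dec Boolₚ._≟_ (Productₚ.≡-dec Boolₚ._≟_ Finₚ._≟_)

  lift-neighbour : Vertex∞ → Vertex n → Vertex∞
  lift-neighbour u w with any? (λ v → project v ≟V w) (nbhd∞ u)
  ... | yes found = proj₁ (find found)
  ... | no _      = u

  lift-neighbour-spec : ∀ {u w} → Adj n (project u) w →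
    Adj∞ u (lift-neighbour u w) × project (lift-neighbour u w) ≡ w
  lift-neighbour-spec {u} {w} uw with any? (λ v → project v ≟V w) (nbhd∞ u)
  ... | yes found = proj₂ (find found)
  ... | no none   = ⊥-elim (none (let _ , uv , v↦w = Adj-lift {u} uw in lose uv v↦w))

  base : Vertex n → Vertex∞
  base (a , b , j) = (a , b , + toℕ j)

  project-base : ∀ v → project (base v) ≡ v
  project-base (a , b , j) = cong (λ z → (a , b , z)) (Finₚ.toℕ-injective (toℕ-wrap (toℕ j) (Finₚ.toℕ<n j)))

  extend : ∀ {K} → (Fin K → Vertex n) → ℕ → Vertex n
  extend {K} p i with i ℕ.<? K
  ... | yes i<K = p (fromℕ< i<K)
  ... | no _    = false , false , Fin.zero

  extend-< : ∀ {K} p i (i<K : i ℕ.< K) → extend p i ≡ p (fromℕ< i<K)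
  extend-< {K} p i i<K with i ℕ.<? K
  ... | yes _  = refl
  ... | no i≮K = ⊥-elim (i≮K i<K)

  strip+1<N : ∀ {c} → c ℕ.≤ 2 ℕ.* m → suc c ℕ.< N
  strip+1<N {c} c≤2m = subst (suc (suc c) ℕ.≤_) (sym (N≡ m)) (s≤s (s≤s c≤2m))
    where
    N≡ : ∀ m → 2 ℕ.* suc m ≡ 2 ℕ.+ 2 ℕ.* m
    N≡ = ℕ-Solver.solve-∀

  strip<N : ∀ {c} → c ℕ.≤ 2 ℕ.* m → c ℕ.< N
  strip<N c≤2m = ℕₚ.<-trans (ℕₚ.n<1+n _) (strip+1<N c≤2m)

  wrap-injective : ∀ {x y} → x ℕ.< N → y ℕ.< N → wrap (+ x) ≡ wrap (+ y) → x ≡ y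
  wrap-injective {x} {y} x<N y<N eq = trans (sym (toℕ-wrap x x<N)) (trans (cong toℕ eq) (toℕ-wrap y y<N))

  strip-injective : ∀ {b b′ c c′} → c ℕ.≤ 2 ℕ.* m → c′ ℕ.≤ 2 ℕ.* m →
    project (false , b , + c) ≡ project (false , b′ , + c′) → (false , b , + c) ≡ (false , b′ , + c′)
  strip-injective c≤2m c′≤2m eq = vertex-≡ refl (cong (proj₁ ∘ proj₂) eq)
    (cong +_ (wrap-injective (strip<N c≤2m) (strip<N c′≤2m) (cong (proj₂ ∘ proj₂) eq)))

  strip-Adj : ∀ {b b′ c c′} → c ℕ.≤ 2 ℕ.* m → c′ ℕ.≤ 2 ℕ.* m →
    Adj n (project (false , b , + c)) (project (false , b′ , + c′)) → Adj∞ (false , b , + c) (false , b′ , + c′)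
  strip-Adj {b} {b′} {c} {c′} c≤2m c′≤2m adj with Adj-lift {false , b , + c} adj
  ... | (a″ , b″ , j″) , uw , w↦v =
    subst (Adj∞ _) (vertex-≡ (cong proj₁ w↦v) (cong (proj₁ ∘ proj₂) w↦v) coord≡) uw
    where
    wrapped : wrap j″ ≡ wrap (+ c′)
    wrapped = cong (proj₂ ∘ proj₂) w↦v
    coord≡ : j″ ≡ + c′
    coord≡ with ladder-neighbour uw (cong proj₁ w↦v)
    ... | inj₁ refl        = cong +_ (wrap-injective (strip<N c≤2m) (strip<N c′≤2m) wrapped)
    ... | inj₂ (inj₂ refl) =
      cong +_ (wrap-injective (subst (ℕ._< N) (ℕₚ.+-comm 1 c) (strip+1<N c≤2m)) (strip<N c′≤2m) wrapped)
    ... | inj₂ (inj₁ refl) = below c refl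
      where
      below : ∀ c₀ → c₀ ≡ c → + c - + 1 ≡ + c′
      below (suc c₀) refl =
        cong +_ (wrap-injective (ℕₚ.<-trans (ℕₚ.n<1+n _) (strip<N c≤2m)) (strip<N c′≤2m) wrapped)
      below zero refl =
        ⊥-elim (ℕₚ.<-irrefl refl (subst (suc c′ ℕ.≤_) (sym c′≡) (ℕₚ.≤-pred (strip+1<N c′≤2m))))
        where
        c′≡ : c′ ≡ N ℕ.∸ 1
        c′≡ = trans (sym (toℕ-wrap c′ (strip<N c′≤2m))) (trans (cong toℕ (sym wrapped)) toℕ-wrap-minus-one)

  module _ {K : ℕ} (path : InducedPath n K) where
    private
      p : Fin K → Vertex n
      p = proj₁ path

      q : ℕ → Vertex n
      q = extend p

      q-adjacent : ∀ i → suc i ℕ.< K → Adj n (q i) (q (suc i))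
      q-adjacent i i+1<K = subst₂ (Adj n) (sym (extend-< p i i<K)) (sym (extend-< p (suc i) i+1<K))
        (Equivalence.from (proj₂ (proj₂ path) _ _)
          (inj₁ (trans (cong suc (Finₚ.toℕ-fromℕ< i<K)) (sym (Finₚ.toℕ-fromℕ< i+1<K)))))
        where
        i<K : i ℕ.< K
        i<K = ℕₚ.<-trans (ℕₚ.n<1+n i) i+1<K

      q-adjacent⇒consecutive : ∀ i j → i ℕ.< K → j ℕ.< K → Adj n (q i) (q j) → suc i ≡ j ⊎ suc j ≡ i
      q-adjacent⇒consecutive i j i<K j<K qi~qj
        with Equivalence.to (proj₂ (proj₂ path) _ _) (subst₂ (Adj n) (extend-< p i i<K) (extend-< p j j<K) qi~qj)
      ... | inj₁ eq = inj₁ (trans (cong suc (sym (Finₚ.toℕ-fromℕ< i<K))) (trans eq (Finₚ.toℕ-fromℕ< j<K)))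
      ... | inj₂ eq = inj₂ (trans (cong suc (sym (Finₚ.toℕ-fromℕ< j<K))) (trans eq (Finₚ.toℕ-fromℕ< i<K)))

      q-injective : ∀ i j → i ℕ.< K → j ℕ.< K → q i ≡ q j → i ≡ j
      q-injective i j i<K j<K eq =
        trans (sym (Finₚ.toℕ-fromℕ< i<K))
          (trans (cong toℕ (proj₁ (proj₂ path) (trans (sym (extend-< p i i<K)) (trans eq (extend-< p j j<K)))))
                 (Finₚ.toℕ-fromℕ< j<K))

    lifted : ℕ → Vertex∞
    lifted zero    = base (q 0)
    lifted (suc i) = lift-neighbour (lifted i) (q (suc i))

    project-lifted : ∀ i → i ℕ.< K → project (lifted i) ≡ q i
    toward-next : ∀ i → suc i ℕ.< K → Adj n (project (lifted i)) (q (suc i))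

    project-lifted zero    _     = project-base (q 0)
    project-lifted (suc i) i+1<K = proj₂ (lift-neighbour-spec (toward-next i i+1<K))

    toward-next i i+1<K =
      subst (λ v → Adj n v (q (suc i))) (sym (project-lifted i (ℕₚ.<-trans (ℕₚ.n<1+n i) i+1<K))) (q-adjacent i i+1<K)

    lifted-path : InducedPath∞ K lifted
    lifted-path = record
      { adjacent = λ i i+1<K → proj₁ (lift-neighbour-spec (toward-next i i+1<K))
      ; adjacent⇒consecutive = λ i j i<K j<K ri~rj → q-adjacent⇒consecutive i j i<K j<K
          (subst₂ (Adj n) (project-lifted i i<K) (project-lifted j j<K) (Adj-project ri~rj))
      ; injective = λ i j i<K j<K eq → q-injective i j i<K j<K
          (trans (sym (project-lifted i i<K)) (trans (cong project eq) (project-lifted j j<K)))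
      }

    lifted-apart : 1 ℕ.≤ m → Apart (+ N) K lifted
    lifted-apart 1≤m = record { disjoint = disjoint ; anticomplete = anticomplete }
      where
      project-translated : ∀ a → a ℕ.< K → project (translate (+ N) (lifted a)) ≡ q a
      project-translated a a<K = trans (project-period (lifted a)) (project-lifted a a<K)

      disjoint : ∀ a b → a ℕ.< K → b ℕ.< K → translate (+ N) (lifted a) ≢ lifted b
      disjoint a b a<K b<K eq
        with q-injective a b a<K b<K (trans (sym (project-translated a a<K)) (trans (cong project eq) (project-lifted b b<K)))
      ... | refl with translate-fixed (+ N) (lifted a) eq
      ...   | ()

      anticomplete : ∀ a b → a ℕ.< K → b ℕ.< K → ¬ Adj∞ (lifted b) (translate (+ N) (lifted a))
      anticomplete a b a<K b<K far-adj =
        four≰two (ℕₚ.≤-trans (ℕₚ.*-monoʳ-≤ 2 (s≤s 1≤m)) (ℤₚ.drop‿+≤+ N≤2))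
        where
        open InducedPath∞ lifted-path
        near-adj : Adj∞ (lifted b) (lifted a)
        near-adj with q-adjacent⇒consecutive b a b<K a<K
          (subst₂ (Adj n) (project-lifted b b<K) (project-translated a a<K) (Adj-project far-adj))
        ... | inj₁ refl = adjacent b a<K
        ... | inj₂ refl = Adj∞-sym (adjacent a b<K)
        far near : ℤ
        far = step (lifted b) (translate (+ N) (lifted a))
        near = step (lifted b) (lifted a)
        N≤2 : + N ≤ + 2
        N≤2 = begin
          + N          ≡⟨ offset (level (lifted a)) (level (lifted b)) (+ N) ⟩
          (level (lifted a) + + N - level (lifted b)) - near
                       ≡⟨ cong (λ ℓ → (ℓ - level (lifted b)) - near) (level-translate (+ N) (lifted a)) ⟨
          far - near   ≤⟨ ℤₚ.+-mono-≤ (unit-step≤1 (Adj∞⇒unit-step far-adj))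
                                       (ℤₚ.neg-mono-≤ (unit-step≥-1 (Adj∞⇒unit-step near-adj))) ⟩
          + 2          ∎
          where
          open ℤₚ.≤-Reasoning
          offset : ∀ x y N → N ≡ (x + N - y) - (x - y)
          offset = solve-∀
        four≰two : ¬ (4 ℕ.≤ 2)
        four≰two (s≤s (s≤s ()))

module Zigzag where
  open ℤ using (_-_)
  open Cover

  row : ℕ → Bool
  row 0 = true
  row 1 = false
  row 2 = false
  row 3 = false
  row 4 = true
  row 5 = true
  row (suc (suc (suc (suc (suc (suc i)))))) = row i

  column : ℕ → ℕ
  column 0 = 0
  column 1 = 0
  column 2 = 1
  column 3 = 2
  column 4 = 2
  column 5 = 3
  column (suc (suc (suc (suc (suc (suc i)))))) = 4 ℕ.+ column i

  zigzag : ℕ → Vertex∞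
  zigzag i = (false , row i , + column i)

  zigzag-period : ∀ i → zigzag (6 ℕ.+ i) ≡ translate (+ 4) (zigzag i)
  zigzag-period i = cong (λ c → (false , row i , + c)) (ℕₚ.+-comm 4 (column i))

  column-suc : ∀ i → column i ℕ.≤ column (suc i)
  column-suc 0 = z≤n
  column-suc 1 = z≤n
  column-suc 2 = s≤s z≤n
  column-suc 3 = ℕₚ.≤-refl
  column-suc 4 = s≤s (s≤s z≤n)
  column-suc 5 = ℕₚ.n≤1+n 3
  column-suc (suc (suc (suc (suc (suc (suc i)))))) = ℕₚ.+-monoʳ-≤ 4 (column-suc i)

  column-monotone : ∀ i d → column i ℕ.≤ column (d ℕ.+ i)
  column-monotone i zero    = ℕₚ.≤-refl
  column-monotone i (suc d) = ℕₚ.≤-trans (column-monotone i d) (column-suc (d ℕ.+ i))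

  column-+4 : ∀ i → 2 ℕ.+ column i ℕ.≤ column (4 ℕ.+ i)
  column-+4 0 = ℕₚ.≤-refl
  column-+4 1 = s≤s (s≤s z≤n)
  column-+4 2 = ℕₚ.n≤1+n 3
  column-+4 3 = ℕₚ.≤-refl
  column-+4 4 = ℕₚ.n≤1+n 4
  column-+4 5 = ℕₚ.n≤1+n 5
  column-+4 (suc (suc (suc (suc (suc (suc i)))))) = ℕₚ.+-monoʳ-≤ 4 (column-+4 i)

  column-gap : ∀ i j → 4 ℕ.+ i ℕ.≤ j → 2 ℕ.+ column i ℕ.≤ column j
  column-gap i j 4+i≤j = ℕₚ.≤-trans (column-+4 i)
    (subst (λ z → column (4 ℕ.+ i) ℕ.≤ column z) (ℕₚ.m∸n+n≡m 4+i≤j)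
           (column-monotone (4 ℕ.+ i) (j ℕ.∸ (4 ℕ.+ i))))

  column-slope : ∀ i → 3 ℕ.* column i ℕ.≤ 2 ℕ.* i
  column-slope 0 = z≤n
  column-slope 1 = z≤n
  column-slope 2 = ℕₚ.n≤1+n 3
  column-slope 3 = ℕₚ.≤-refl
  column-slope 4 = ℕₚ.m≤m+n 6 2
  column-slope 5 = ℕₚ.n≤1+n 9
  column-slope (suc (suc (suc (suc (suc (suc i)))))) =
    subst₂ ℕ._≤_ (lhs (column i)) (rhs i) (ℕₚ.+-monoʳ-≤ 12 (column-slope i))
    where
    lhs : ∀ c → 12 ℕ.+ 3 ℕ.* c ≡ 3 ℕ.* (4 ℕ.+ c)
    lhs = ℕ-Solver.solve-∀
    rhs : ∀ i → 12 ℕ.+ 2 ℕ.* i ≡ 2 ℕ.* (6 ℕ.+ i)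
    rhs = ℕ-Solver.solve-∀

  zigzag-reach : ∀ i j → Adj∞ (zigzag i) (zigzag j) → column j ℕ.≤ suc (column i)
  zigzag-reach i j adj with ladder-neighbour adj refl
  ... | inj₁ same = ℕₚ.≤-trans (ℕₚ.≤-reflexive (ℤₚ.+-injective same)) (ℕₚ.n≤1+n _)
  ... | inj₂ (inj₂ up) = ℕₚ.≤-reflexive (trans (ℤₚ.+-injective up) (ℕₚ.+-comm (column i) 1))
  ... | inj₂ (inj₁ down) = below (column i) down
    where
    below : ∀ c → + column j ≡ + c - + 1 → column j ℕ.≤ suc c
    below (suc c) eq = ℕₚ.≤-trans (ℕₚ.≤-reflexive (ℤₚ.+-injective eq)) (ℕₚ.m≤n⇒m≤1+n (ℕₚ.n≤1+n c))

  Near : ℕ → ℕ → Set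
  Near i j = suc i ≡ j ⊎ suc j ≡ i

  near? : ∀ i j → Dec (Near i j)
  near? i j = suc i ℕ.≟ j ⊎-dec suc j ℕ.≟ i

  record Faithful (i j : ℕ) : Set where
    constructor faithful
    field
      adjacent⇒near : Adj∞ (zigzag i) (zigzag j) → Near i j
      near⇒adjacent : Near i j → Adj∞ (zigzag i) (zigzag j)
      injective : zigzag i ≡ zigzag j → i ≡ j

  faithful? : ∀ i j → Dec (Faithful i j)
  faithful? i j =
    map′ (λ (a , b , c) → faithful a b c) (λ (faithful a b c) → a , b , c)
         ((adj? (zigzag i) (zigzag j) →-dec near? i j) ×-dec (near? i j →-dec adj? (zigzag i) (zigzag j))
          ×-dec (zigzag i ≟∞ zigzag j →-dec i ℕ.≟ j))

  opaque
    faithful-below-9 : All (λ i → All (Faithful i) (upTo 9)) (upTo 9)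
    faithful-below-9 = by-evaluation (all? (λ i → all? (faithful? i) (upTo 9)) (upTo 9)) refl

  faithful-period : ∀ {i j} → Faithful i j → Faithful (6 ℕ.+ i) (6 ℕ.+ j)
  faithful-period {i} {j} (faithful adjacent⇒near near⇒adjacent injective) = faithful
    (shift-near ∘ adjacent⇒near ∘ lower) (raise ∘ near⇒adjacent ∘ unshift-near) (cong (6 ℕ.+_) ∘ injective ∘ unperiod)
    where
    lower : Adj∞ (zigzag (6 ℕ.+ i)) (zigzag (6 ℕ.+ j)) → Adj∞ (zigzag i) (zigzag j)
    lower adj = Adj∞-translate⁻ (+ 4) (subst₂ Adj∞ (zigzag-period i) (zigzag-period j) adj)
    raise : Adj∞ (zigzag i) (zigzag j) → Adj∞ (zigzag (6 ℕ.+ i)) (zigzag (6 ℕ.+ j))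
    raise adj = subst₂ Adj∞ (sym (zigzag-period i)) (sym (zigzag-period j)) (Adj∞-translate (+ 4) adj)
    unperiod : zigzag (6 ℕ.+ i) ≡ zigzag (6 ℕ.+ j) → zigzag i ≡ zigzag j
    unperiod eq = translate-injective (+ 4) (trans (sym (zigzag-period i)) (trans eq (zigzag-period j)))
    shift-near : Near i j → Near (6 ℕ.+ i) (6 ℕ.+ j)
    shift-near (inj₁ eq) = inj₁ (cong (6 ℕ.+_) eq)
    shift-near (inj₂ eq) = inj₂ (cong (6 ℕ.+_) eq)
    unshift-near : Near (6 ℕ.+ i) (6 ℕ.+ j) → Near i j
    unshift-near (inj₁ eq) = inj₁ (ℕₚ.+-cancelˡ-≡ 6 _ _ eq)
    unshift-near (inj₂ eq) = inj₂ (ℕₚ.+-cancelˡ-≡ 6 _ _ eq)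

  faithful-sym : ∀ {i j} → Faithful i j → Faithful j i
  faithful-sym (faithful adjacent⇒near near⇒adjacent injective) = faithful
    (λ adj → swap (adjacent⇒near (Adj∞-sym adj)))
    (λ near → Adj∞-sym (near⇒adjacent (swap near)))
    (λ eq → sym (injective (sym eq)))
    where
    swap : ∀ {i j} → Near i j → Near j i
    swap (inj₁ eq) = inj₂ eq
    swap (inj₂ eq) = inj₁ eq

  faithful-far : ∀ i j → 4 ℕ.+ i ℕ.≤ j → Faithful i j
  faithful-far i j 4+i≤j = faithful
    (λ adj → ⊥-elim (ℕₚ.<-irrefl refl (ℕₚ.≤-trans gap (zigzag-reach i j adj))))
    (λ { (inj₁ refl) → ⊥-elim (ℕₚ.<-irrefl refl (ℕₚ.≤-trans (ℕₚ.m≤n+m (suc (suc i)) 2) 4+i≤j))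
       ; (inj₂ refl) → ⊥-elim (ℕₚ.<-irrefl refl (ℕₚ.≤-trans (ℕₚ.m≤n+m (suc j) 4) 4+i≤j)) })
    (λ eq → ⊥-elim (ℕₚ.<-irrefl refl (ℕₚ.≤-trans (ℕₚ.m≤n+m _ 1)
                      (subst (λ c → 2 ℕ.+ c ℕ.≤ column j) (ℤₚ.+-injective (cong coord eq)) gap))))
    where
    gap : 2 ℕ.+ column i ℕ.≤ column j
    gap = column-gap i j 4+i≤j

  faithful-close : ∀ i j → j ℕ.≤ 3 ℕ.+ i → i ℕ.≤ 3 ℕ.+ j → Faithful i j
  faithful-close = <-rec _ reduce
    where
    small : ∀ {i j} → i ℕ.< 9 → j ℕ.< 9 → Faithful i j
    small i<9 j<9 = All.lookup (All.lookup faithful-below-9 (∈-upTo⁺ i<9)) (∈-upTo⁺ j<9)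
    close-below-9 : ∀ {i j} → i ℕ.< 6 → j ℕ.≤ 3 ℕ.+ i → j ℕ.< 9
    close-below-9 i<6 j≤ = s≤s (ℕₚ.≤-trans j≤ (ℕₚ.+-monoʳ-≤ 3 (ℕₚ.≤-pred i<6)))
    reduce : ∀ i → (∀ {i′} → i′ ℕ.< i → ∀ j → j ℕ.≤ 3 ℕ.+ i′ → i′ ℕ.≤ 3 ℕ.+ j → Faithful i′ j) →
             ∀ j → j ℕ.≤ 3 ℕ.+ i → i ℕ.≤ 3 ℕ.+ j → Faithful i j
    reduce i rec j j≤ i≤ with i ℕ.<? 6 | j ℕ.<? 6
    ... | yes i<6 | _     = small (ℕₚ.≤-trans i<6 (ℕₚ.m≤m+n 6 3)) (close-below-9 i<6 j≤)
    ... | no _ | yes j<6  = small (close-below-9 j<6 i≤) (ℕₚ.≤-trans j<6 (ℕₚ.m≤m+n 6 3))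
    ... | no i≮6 | no j≮6 = subst₂ Faithful (ℕₚ.m+[n∸m]≡n 6≤i) (ℕₚ.m+[n∸m]≡n 6≤j)
        (faithful-period (rec (ℕₚ.∸-monoʳ-< (s≤s z≤n) 6≤i) (j ℕ.∸ 6)
          (ℕₚ.≤-trans (ℕₚ.∸-monoˡ-≤ 6 j≤) (ℕₚ.≤-reflexive (ℕₚ.+-∸-assoc 3 6≤i)))
          (ℕₚ.≤-trans (ℕₚ.∸-monoˡ-≤ 6 i≤) (ℕₚ.≤-reflexive (ℕₚ.+-∸-assoc 3 6≤j)))))
      where
      6≤i : 6 ℕ.≤ i
      6≤i = ℕₚ.≮⇒≥ i≮6
      6≤j : 6 ℕ.≤ j
      6≤j = ℕₚ.≮⇒≥ j≮6

  zigzag-faithful : ∀ i j → Faithful i j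
  zigzag-faithful i j with j ℕ.≤? 3 ℕ.+ i | i ℕ.≤? 3 ℕ.+ j
  ... | yes j≤ | yes i≤ = faithful-close i j j≤ i≤
  ... | no j≰  | _      = faithful-far i j (ℕₚ.≰⇒> j≰)
  ... | yes _  | no i≰  = faithful-sym (faithful-far j i (ℕₚ.≰⇒> i≰))

  module _ (m : ℕ) where
    open Projection m

    long-induced-path : InducedPath n (3 ℕ.* n ℕ.∸ 1)
    long-induced-path = p , p-injective , p-adjacency
      where
      K : ℕ
      K = 3 ℕ.* n ℕ.∸ 1
      p : Fin K → Vertex n
      p i = project (zigzag (toℕ i))
      in-strip : ∀ (i : Fin K) → column (toℕ i) ℕ.≤ 2 ℕ.* m
      in-strip i with column (toℕ i) ℕ.≤? 2 ℕ.* m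
      ... | yes in-range = in-range
      ... | no out-of-range = ⊥-elim (ℕₚ.<-irrefl refl (ℕₚ.≤-trans (ℕₚ.≤-reflexive (outer m))
            (ℕₚ.≤-trans (ℕₚ.*-monoʳ-≤ 3 (ℕₚ.≰⇒> out-of-range))
            (ℕₚ.≤-trans (column-slope (toℕ i)) (ℕₚ.*-monoʳ-≤ 2 index-bound)))))
        where
        outer : ∀ m → suc (2 ℕ.* (1 ℕ.+ 3 ℕ.* m)) ≡ 3 ℕ.* suc (2 ℕ.* m)
        outer = ℕ-Solver.solve-∀
        length≡ : ∀ m → m ℕ.+ 2 ℕ.* suc m ≡ suc (1 ℕ.+ 3 ℕ.* m)
        length≡ = ℕ-Solver.solve-∀
        index-bound : toℕ i ℕ.≤ 1 ℕ.+ 3 ℕ.* m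
        index-bound = ℕₚ.≤-pred (subst (toℕ i ℕ.<_) (length≡ m) (Finₚ.toℕ<n i))
      p-injective : ∀ {i j} → p i ≡ p j → i ≡ j
      p-injective {i} {j} eq = Finₚ.toℕ-injective (Faithful.injective (zigzag-faithful (toℕ i) (toℕ j))
                                 (strip-injective (in-strip i) (in-strip j) eq))
      p-adjacency : ∀ i j → Adj n (p i) (p j) ⇔ Near (toℕ i) (toℕ j)
      p-adjacency i j = mk⇔
        (λ adj → Faithful.adjacent⇒near (zigzag-faithful (toℕ i) (toℕ j)) (strip-Adj (in-strip i) (in-strip j) adj))
        (λ near → Adj-project (Faithful.near⇒adjacent (zigzag-faithful (toℕ i) (toℕ j)) near))

module Windows where
  open ℤ using (ℤ; _+_; _-_; -_; _*_; _≤_)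
  open Cover

  Rising : ℤ → Set
  Rising d = d ≡ + 0 ⊎ d ≡ + 1

  Falling : ℤ → Set
  Falling d = d ≡ + 0 ⊎ d ≡ -[1+ 0 ]

  rising? : ∀ d → Dec (Rising d)
  rising? d = d ℤₚ.≟ + 0 ⊎-dec d ℤₚ.≟ + 1

  falling? : ∀ d → Dec (Falling d)
  falling? d = d ℤₚ.≟ + 0 ⊎-dec d ℤₚ.≟ -[1+ 0 ]

  rising≤1 : ∀ {d} → Rising d → d ≤ + 1
  rising≤1 (inj₁ refl) = +≤+ z≤n
  rising≤1 (inj₂ refl) = ℤₚ.≤-refl

  -- Along an ascending path a flat step costs 2 and a rising step −1. After the steps t, t′,
  -- debt t t′ is what is still owed for the last flat step; a flat step needs the debt to be
  -- paid off, so no step costs more than the change of debt it causes.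
  cost : ℤ → ℤ
  cost d = + 2 - + 3 * d

  debt : ℤ → ℤ → ℤ
  debt _     (+ 0) = + 2
  debt (+ 0) _     = + 1
  debt _     _     = + 0

  normalizeAt : Vertex∞ → List Vertex∞ → List Vertex∞
  normalizeAt v = map (translate (- level v))

  shape : Vertex∞ → Vertex∞ → Vertex∞ → List Vertex∞
  shape x y z = normalizeAt y (x ∷ y ∷ z ∷ [])

  -- The data of seven consecutive vertices x₀ … x₆ that the classification looks at: the
  -- level steps tᵢ, the triples xᵢ xᵢ₊₁ xᵢ₊₂ translated to put xᵢ₊₁ on level 0, and the first
  -- two and last three vertices translated to put x₀, respectively x₆, on level 0.
  record Signature : Set where
    constructor mkSignature
    field
      t₀ t₁ t₂ t₃ t₄ t₅ : ℤ
      shape₀ shape₁ shape₂ shape₃ shape₄ : List Vertex∞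
      head tail : List Vertex∞

  signature : (x₀ x₁ x₂ x₃ x₄ x₅ x₆ : Vertex∞) → Signature
  signature x₀ x₁ x₂ x₃ x₄ x₅ x₆ =
    mkSignature (step x₀ x₁) (step x₁ x₂) (step x₂ x₃) (step x₃ x₄) (step x₄ x₅) (step x₅ x₆)
                (shape x₀ x₁ x₂) (shape x₁ x₂ x₃) (shape x₂ x₃ x₄) (shape x₃ x₄ x₅) (shape x₄ x₅ x₆)
                (normalizeAt x₀ (x₀ ∷ x₁ ∷ [])) (normalizeAt x₆ (x₄ ∷ x₅ ∷ x₆ ∷ []))

  startPotential : Signature → ℤ
  startPotential σ = cost t₀ + cost t₁ + cost t₂ + cost t₃ - debt t₂ t₃
    where open Signature σ

  endPotential : Signature → ℤ
  endPotential σ = debt t₂ t₃ + cost t₄ + cost t₅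
    where open Signature σ

  Bounded : List Vertex∞ → ℤ → List (List Vertex∞ × ℤ) → Set
  Bounded key value = Any (λ entry → proj₁ entry ≡ key × value ≤ proj₂ entry)

  bounded? : ∀ key value table → Dec (Bounded key value table)
  bounded? key value = any? (λ entry → Listₚ.≡-dec _≟∞_ (proj₁ entry) key ×-dec value ℤₚ.≤? proj₂ entry)
  -- Found by enumerating seven-vertex induced paths: the triples occurring in ascending ones,
  -- and for every possible head or tail the largest start or end potential over them.
  risingShapes : List (List Vertex∞)
  risingShapes =
    ((false , false , -[1+ 0 ]) ∷ (false , false , + 0) ∷ (false , false , + 1) ∷ []) ∷
    ((false , false , -[1+ 0 ]) ∷ (false , false , + 0) ∷ (false , true , + 0) ∷ []) ∷
    ((false , false , -[1+ 0 ]) ∷ (false , false , + 0) ∷ (true , false , + 2) ∷ []) ∷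
    ((false , false , -[1+ 0 ]) ∷ (false , false , + 0) ∷ (true , true , + 0) ∷ []) ∷
    ((false , false , -[1+ 0 ]) ∷ (true , false , + 1) ∷ (false , true , + 1) ∷ []) ∷
    ((false , false , -[1+ 0 ]) ∷ (true , false , + 1) ∷ (true , true , + 0) ∷ []) ∷
    ((false , false , -[1+ 0 ]) ∷ (true , false , + 1) ∷ (true , true , + 1) ∷ []) ∷
    ((false , false , -[1+ 0 ]) ∷ (true , false , + 1) ∷ (true , true , + 2) ∷ []) ∷
    ((false , false , + 0) ∷ (false , true , + 0) ∷ (false , true , + 1) ∷ []) ∷
    ((false , false , + 0) ∷ (false , true , + 0) ∷ (true , true , + 2) ∷ []) ∷
    ((false , false , + 1) ∷ (false , false , + 0) ∷ (true , false , + 2) ∷ []) ∷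
    ((false , false , + 1) ∷ (true , true , + 1) ∷ (true , false , + 2) ∷ []) ∷
    ((false , true , -[1+ 0 ]) ∷ (false , true , + 0) ∷ (false , false , + 0) ∷ []) ∷
    ((false , true , -[1+ 0 ]) ∷ (false , true , + 0) ∷ (false , true , + 1) ∷ []) ∷
    ((false , true , -[1+ 0 ]) ∷ (false , true , + 0) ∷ (true , false , + 0) ∷ []) ∷
    ((false , true , -[1+ 0 ]) ∷ (false , true , + 0) ∷ (true , true , + 2) ∷ []) ∷
    ((false , true , -[1+ 0 ]) ∷ (true , true , + 1) ∷ (false , false , + 1) ∷ []) ∷
    ((false , true , -[1+ 0 ]) ∷ (true , true , + 1) ∷ (true , false , + 0) ∷ []) ∷
    ((false , true , -[1+ 0 ]) ∷ (true , true , + 1) ∷ (true , false , + 1) ∷ []) ∷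
    ((false , true , -[1+ 0 ]) ∷ (true , true , + 1) ∷ (true , false , + 2) ∷ []) ∷
    ((false , true , + 0) ∷ (false , false , + 0) ∷ (false , false , + 1) ∷ []) ∷
    ((false , true , + 0) ∷ (false , false , + 0) ∷ (true , false , + 2) ∷ []) ∷
    ((false , true , + 1) ∷ (false , true , + 0) ∷ (true , true , + 2) ∷ []) ∷
    ((false , true , + 1) ∷ (true , false , + 1) ∷ (true , true , + 2) ∷ []) ∷
    ((true , false , + 0) ∷ (false , true , + 0) ∷ (false , false , + 0) ∷ []) ∷
    ((true , false , + 0) ∷ (false , true , + 0) ∷ (false , true , -[1+ 0 ]) ∷ []) ∷
    ((true , false , + 0) ∷ (false , true , + 0) ∷ (false , true , + 1) ∷ []) ∷
    ((true , false , + 0) ∷ (false , true , + 0) ∷ (true , true , + 2) ∷ []) ∷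
    ((true , false , + 0) ∷ (true , true , + 1) ∷ (false , false , + 1) ∷ []) ∷
    ((true , false , + 0) ∷ (true , true , + 1) ∷ (false , true , -[1+ 0 ]) ∷ []) ∷
    ((true , false , + 0) ∷ (true , true , + 1) ∷ (true , false , + 1) ∷ []) ∷
    ((true , false , + 0) ∷ (true , true , + 1) ∷ (true , false , + 2) ∷ []) ∷
    ((true , false , + 1) ∷ (true , true , + 1) ∷ (false , false , + 1) ∷ []) ∷
    ((true , false , + 1) ∷ (true , true , + 1) ∷ (true , false , + 2) ∷ []) ∷
    ((true , false , + 2) ∷ (false , false , + 0) ∷ (false , false , + 1) ∷ []) ∷
    ((true , false , + 2) ∷ (true , true , + 1) ∷ (false , false , + 1) ∷ []) ∷
    ((true , true , + 0) ∷ (false , false , + 0) ∷ (false , false , -[1+ 0 ]) ∷ []) ∷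
    ((true , true , + 0) ∷ (false , false , + 0) ∷ (false , false , + 1) ∷ []) ∷
    ((true , true , + 0) ∷ (false , false , + 0) ∷ (false , true , + 0) ∷ []) ∷
    ((true , true , + 0) ∷ (false , false , + 0) ∷ (true , false , + 2) ∷ []) ∷
    ((true , true , + 0) ∷ (true , false , + 1) ∷ (false , false , -[1+ 0 ]) ∷ []) ∷
    ((true , true , + 0) ∷ (true , false , + 1) ∷ (false , true , + 1) ∷ []) ∷
    ((true , true , + 0) ∷ (true , false , + 1) ∷ (true , true , + 1) ∷ []) ∷
    ((true , true , + 0) ∷ (true , false , + 1) ∷ (true , true , + 2) ∷ []) ∷
    ((true , true , + 1) ∷ (true , false , + 1) ∷ (false , true , + 1) ∷ []) ∷
    ((true , true , + 1) ∷ (true , false , + 1) ∷ (true , true , + 2) ∷ []) ∷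
    ((true , true , + 2) ∷ (false , true , + 0) ∷ (false , true , + 1) ∷ []) ∷
    ((true , true , + 2) ∷ (true , false , + 1) ∷ (false , true , + 1) ∷ []) ∷
    []

  startBounds : List (List Vertex∞ × ℤ)
  startBounds =
    (((false , false , + 0) ∷ (false , false , -[1+ 0 ]) ∷ []) , + 2) ∷
    (((false , false , + 0) ∷ (false , false , + 1) ∷ []) , -[1+ 0 ]) ∷
    (((false , false , + 0) ∷ (false , true , + 0) ∷ []) , + 0) ∷
    (((false , false , + 0) ∷ (true , false , + 2) ∷ []) , -[1+ 0 ]) ∷
    (((false , false , + 0) ∷ (true , true , + 0) ∷ []) , + 2) ∷
    (((false , true , + 0) ∷ (false , false , + 0) ∷ []) , + 0) ∷
    (((false , true , + 0) ∷ (false , true , -[1+ 0 ]) ∷ []) , + 2) ∷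
    (((false , true , + 0) ∷ (false , true , + 1) ∷ []) , -[1+ 0 ]) ∷
    (((false , true , + 0) ∷ (true , false , + 0) ∷ []) , + 2) ∷
    (((false , true , + 0) ∷ (true , true , + 2) ∷ []) , -[1+ 0 ]) ∷
    (((true , false , + 1) ∷ (false , false , -[1+ 0 ]) ∷ []) , + 2) ∷
    (((true , false , + 1) ∷ (false , true , + 1) ∷ []) , -[1+ 0 ]) ∷
    (((true , false , + 1) ∷ (true , true , + 0) ∷ []) , + 2) ∷
    (((true , false , + 1) ∷ (true , true , + 1) ∷ []) , + 0) ∷
    (((true , false , + 1) ∷ (true , true , + 2) ∷ []) , -[1+ 0 ]) ∷
    (((true , true , + 1) ∷ (false , false , + 1) ∷ []) , -[1+ 0 ]) ∷
    (((true , true , + 1) ∷ (false , true , -[1+ 0 ]) ∷ []) , + 2) ∷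
    (((true , true , + 1) ∷ (true , false , + 0) ∷ []) , + 2) ∷
    (((true , true , + 1) ∷ (true , false , + 1) ∷ []) , + 0) ∷
    (((true , true , + 1) ∷ (true , false , + 2) ∷ []) , -[1+ 0 ]) ∷
    []

  endBounds : List (List Vertex∞ × ℤ)
  endBounds =
    (((false , false , -[1+ 1 ]) ∷ (false , false , -[1+ 0 ]) ∷ (false , false , + 0) ∷ []) , + 0) ∷
    (((false , false , -[1+ 1 ]) ∷ (false , false , -[1+ 0 ]) ∷ (true , false , + 1) ∷ []) , + 0) ∷
    (((false , false , -[1+ 1 ]) ∷ (true , false , + 0) ∷ (false , true , + 0) ∷ []) , + 0) ∷
    (((false , false , -[1+ 1 ]) ∷ (true , false , + 0) ∷ (true , true , + 1) ∷ []) , + 0) ∷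
    (((false , false , -[1+ 0 ]) ∷ (false , false , + 0) ∷ (false , true , + 0) ∷ []) , + 2) ∷
    (((false , false , -[1+ 0 ]) ∷ (false , true , -[1+ 0 ]) ∷ (false , true , + 0) ∷ []) , + 1) ∷
    (((false , false , -[1+ 0 ]) ∷ (false , true , -[1+ 0 ]) ∷ (true , true , + 1) ∷ []) , + 1) ∷
    (((false , false , -[1+ 0 ]) ∷ (true , false , + 1) ∷ (true , true , + 1) ∷ []) , + 2) ∷
    (((false , false , + 0) ∷ (false , false , + 1) ∷ (true , true , + 1) ∷ []) , + 4) ∷
    (((false , false , + 0) ∷ (true , false , + 2) ∷ (true , true , + 1) ∷ []) , + 4) ∷
    (((false , true , -[1+ 1 ]) ∷ (false , true , -[1+ 0 ]) ∷ (false , true , + 0) ∷ []) , + 0) ∷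
    (((false , true , -[1+ 1 ]) ∷ (false , true , -[1+ 0 ]) ∷ (true , true , + 1) ∷ []) , + 0) ∷
    (((false , true , -[1+ 1 ]) ∷ (true , true , + 0) ∷ (false , false , + 0) ∷ []) , + 0) ∷
    (((false , true , -[1+ 1 ]) ∷ (true , true , + 0) ∷ (true , false , + 1) ∷ []) , + 0) ∷
    (((false , true , -[1+ 0 ]) ∷ (false , false , -[1+ 0 ]) ∷ (false , false , + 0) ∷ []) , + 1) ∷
    (((false , true , -[1+ 0 ]) ∷ (false , false , -[1+ 0 ]) ∷ (true , false , + 1) ∷ []) , + 1) ∷
    (((false , true , -[1+ 0 ]) ∷ (false , true , + 0) ∷ (false , false , + 0) ∷ []) , + 2) ∷
    (((false , true , -[1+ 0 ]) ∷ (true , true , + 1) ∷ (true , false , + 1) ∷ []) , + 2) ∷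
    (((false , true , + 0) ∷ (false , true , + 1) ∷ (true , false , + 1) ∷ []) , + 4) ∷
    (((false , true , + 0) ∷ (true , true , + 2) ∷ (true , false , + 1) ∷ []) , + 4) ∷
    (((true , false , -[1+ 0 ]) ∷ (false , true , -[1+ 0 ]) ∷ (false , true , + 0) ∷ []) , + 0) ∷
    (((true , false , -[1+ 0 ]) ∷ (false , true , -[1+ 0 ]) ∷ (true , true , + 1) ∷ []) , + 0) ∷
    (((true , false , -[1+ 0 ]) ∷ (true , true , + 0) ∷ (false , false , + 0) ∷ []) , + 0) ∷
    (((true , false , -[1+ 0 ]) ∷ (true , true , + 0) ∷ (true , false , + 1) ∷ []) , + 0) ∷
    (((true , false , + 0) ∷ (false , true , + 0) ∷ (false , false , + 0) ∷ []) , + 2) ∷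
    (((true , false , + 0) ∷ (true , true , + 0) ∷ (false , false , + 0) ∷ []) , + 1) ∷
    (((true , false , + 0) ∷ (true , true , + 0) ∷ (true , false , + 1) ∷ []) , + 1) ∷
    (((true , false , + 0) ∷ (true , true , + 1) ∷ (true , false , + 1) ∷ []) , + 2) ∷
    (((true , false , + 1) ∷ (false , true , + 1) ∷ (false , true , + 0) ∷ []) , + 4) ∷
    (((true , false , + 1) ∷ (true , true , + 2) ∷ (false , true , + 0) ∷ []) , + 4) ∷
    (((true , true , -[1+ 0 ]) ∷ (false , false , -[1+ 0 ]) ∷ (false , false , + 0) ∷ []) , + 0) ∷
    (((true , true , -[1+ 0 ]) ∷ (false , false , -[1+ 0 ]) ∷ (true , false , + 1) ∷ []) , + 0) ∷
    (((true , true , -[1+ 0 ]) ∷ (true , false , + 0) ∷ (false , true , + 0) ∷ []) , + 0) ∷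
    (((true , true , -[1+ 0 ]) ∷ (true , false , + 0) ∷ (true , true , + 1) ∷ []) , + 0) ∷
    (((true , true , + 0) ∷ (false , false , + 0) ∷ (false , true , + 0) ∷ []) , + 2) ∷
    (((true , true , + 0) ∷ (true , false , + 0) ∷ (false , true , + 0) ∷ []) , + 1) ∷
    (((true , true , + 0) ∷ (true , false , + 0) ∷ (true , true , + 1) ∷ []) , + 1) ∷
    (((true , true , + 0) ∷ (true , false , + 1) ∷ (true , true , + 1) ∷ []) , + 2) ∷
    (((true , true , + 1) ∷ (false , false , + 1) ∷ (false , false , + 0) ∷ []) , + 4) ∷
    (((true , true , + 1) ∷ (true , false , + 2) ∷ (false , false , + 0) ∷ []) , + 4) ∷
    []

  record Ascending (σ : Signature) : Set where
    constructor ascending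
    open Signature σ
    field
      rising₁ : Rising t₁
      rising₂ : Rising t₂
      rising₃ : Rising t₃
      rising₄ : Rising t₄
      climbs : t₂ ≡ + 1 ⊎ t₃ ≡ + 1 ⊎ t₄ ≡ + 1
      flat-after-two-rises : t₃ ≡ + 0 → t₁ ≡ + 1 × t₂ ≡ + 1
      shape₀-rising : shape₀ ∈ risingShapes
      shape₁-rising : shape₁ ∈ risingShapes
      shape₂-rising : shape₂ ∈ risingShapes
      shape₃-rising : shape₃ ∈ risingShapes
      shape₄-rising : shape₄ ∈ risingShapes
      start-bounded : Bounded head (startPotential σ) startBounds
      end-bounded : Bounded tail (endPotential σ) endBounds

  record Descending (σ : Signature) : Set where
    constructor descending
    open Signature σ
    field
      falling₁ : Falling t₁
      falling₂ : Falling t₂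
      falling₃ : Falling t₃
      descends : t₂ ≡ -[1+ 0 ] ⊎ t₃ ≡ -[1+ 0 ] ⊎ t₄ ≡ -[1+ 0 ]

  ascending? : ∀ σ → Dec (Ascending σ)
  ascending? σ =
    map′ (λ (r₁ , r₂ , r₃ , r₄ , c , f , s₀ , s₁ , s₂ , s₃ , s₄ , b , e) →
            ascending r₁ r₂ r₃ r₄ c f s₀ s₁ s₂ s₃ s₄ b e)
         (λ (ascending r₁ r₂ r₃ r₄ c f s₀ s₁ s₂ s₃ s₄ b e) →
            r₁ , r₂ , r₃ , r₄ , c , f , s₀ , s₁ , s₂ , s₃ , s₄ , b , e)
         (rising? t₁ ×-dec rising? t₂ ×-dec rising? t₃ ×-dec rising? t₄ ×-dec
          (t₂ ℤₚ.≟ + 1 ⊎-dec t₃ ℤₚ.≟ + 1 ⊎-dec t₄ ℤₚ.≟ + 1) ×-dec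
          (t₃ ℤₚ.≟ + 0 →-dec t₁ ℤₚ.≟ + 1 ×-dec t₂ ℤₚ.≟ + 1) ×-dec
          rising-shape? shape₀ ×-dec rising-shape? shape₁ ×-dec rising-shape? shape₂ ×-dec
          rising-shape? shape₃ ×-dec rising-shape? shape₄ ×-dec
          bounded? head (startPotential σ) startBounds ×-dec bounded? tail (endPotential σ) endBounds)
    where
    open Signature σ
    rising-shape? : ∀ s → Dec (s ∈ risingShapes)
    rising-shape? s = _∈?_ (Listₚ.≡-dec _≟∞_) s risingShapes

  descending? : ∀ σ → Dec (Descending σ)
  descending? σ =
    map′ (λ (f₁ , f₂ , f₃ , d) → descending f₁ f₂ f₃ d)
         (λ (descending f₁ f₂ f₃ d) → f₁ , f₂ , f₃ , d)
         (falling? t₁ ×-dec falling? t₂ ×-dec falling? t₃ ×-dec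
          (t₂ ℤₚ.≟ -[1+ 0 ] ⊎-dec t₃ ℤₚ.≟ -[1+ 0 ] ⊎-dec t₄ ℤₚ.≟ -[1+ 0 ]))
    where open Signature σ

  Classified : List Vertex∞ → Set
  Classified (x₆ ∷ x₅ ∷ x₄ ∷ x₃ ∷ x₂ ∷ x₁ ∷ x₀ ∷ []) =
    Ascending (signature x₀ x₁ x₂ x₃ x₄ x₅ x₆) ⊎ Descending (signature x₀ x₁ x₂ x₃ x₄ x₅ x₆)
  Classified _ = ⊤

  classified? : ∀ q → Dec (Classified q)
  classified? (x₆ ∷ x₅ ∷ x₄ ∷ x₃ ∷ x₂ ∷ x₁ ∷ x₀ ∷ []) =
    ascending? (signature x₀ x₁ x₂ x₃ x₄ x₅ x₆) ⊎-dec descending? (signature x₀ x₁ x₂ x₃ x₄ x₅ x₆)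
  classified? [] = yes tt
  classified? (_ ∷ []) = yes tt
  classified? (_ ∷ _ ∷ []) = yes tt
  classified? (_ ∷ _ ∷ _ ∷ []) = yes tt
  classified? (_ ∷ _ ∷ _ ∷ _ ∷ []) = yes tt
  classified? (_ ∷ _ ∷ _ ∷ _ ∷ _ ∷ []) = yes tt
  classified? (_ ∷ _ ∷ _ ∷ _ ∷ _ ∷ _ ∷ []) = yes tt
  classified? (_ ∷ _ ∷ _ ∷ _ ∷ _ ∷ _ ∷ _ ∷ _ ∷ _) = yes tt

  opaque
    seven-vertex-windows-classified : All Classified (inducedPathsAtOrigin 6)
    seven-vertex-windows-classified = by-evaluation (all? classified? (inducedPathsAtOrigin 6)) refl

  map-translate-translate : ∀ c d xs → map (translate c) (map (translate d) xs) ≡ map (translate (d + c)) xs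
  map-translate-translate c d xs = trans (sym (Listₚ.map-∘ xs)) (Listₚ.map-cong (translate-translate c d) xs)

  normalizeAt-translate : ∀ c v xs → normalizeAt (translate c v) (map (translate c) xs) ≡ normalizeAt v xs
  normalizeAt-translate c v xs = begin
    map (translate (- level (translate c v))) (map (translate c) xs)
      ≡⟨ map-translate-translate _ c xs ⟩
    map (translate (c + - level (translate c v))) xs
      ≡⟨ cong (λ e → map (translate (c + - e)) xs) (level-translate c v) ⟩
    map (translate (c + - (level v + c))) xs
      ≡⟨ cong (λ e → map (translate e) xs) (cancel c (level v)) ⟩
    map (translate (- level v)) xs ∎
    where
    open ≡-Reasoning
    cancel : ∀ c ℓ → c + - (ℓ + c) ≡ - ℓ
    cancel = solve-∀

  shape-translate : ∀ c x y z → shape (translate c x) (translate c y) (translate c z) ≡ shape x y z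
  shape-translate c x y z = normalizeAt-translate c y (x ∷ y ∷ z ∷ [])

  signature-translate : ∀ c x₀ x₁ x₂ x₃ x₄ x₅ x₆ →
    signature (translate c x₀) (translate c x₁) (translate c x₂) (translate c x₃)
              (translate c x₄) (translate c x₅) (translate c x₆)
    ≡ signature x₀ x₁ x₂ x₃ x₄ x₅ x₆
  signature-translate c x₀ x₁ x₂ x₃ x₄ x₅ x₆ = congₙ 13 mkSignature
    (step-translate c x₀ x₁) (step-translate c x₁ x₂) (step-translate c x₂ x₃)
    (step-translate c x₃ x₄) (step-translate c x₄ x₅) (step-translate c x₅ x₆)
    (shape-translate c x₀ x₁ x₂) (shape-translate c x₁ x₂ x₃) (shape-translate c x₂ x₃ x₄)
    (shape-translate c x₃ x₄ x₅) (shape-translate c x₄ x₅ x₆)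
    (normalizeAt-translate c x₀ (x₀ ∷ x₁ ∷ [])) (normalizeAt-translate c x₆ (x₄ ∷ x₅ ∷ x₆ ∷ []))

  windowAt : (ℕ → Vertex∞) → ℕ → Signature
  windowAt r w = signature (r w) (r (1 ℕ.+ w)) (r (2 ℕ.+ w)) (r (3 ℕ.+ w)) (r (4 ℕ.+ w)) (r (5 ℕ.+ w)) (r (6 ℕ.+ w))

  -- Opaque for the same reason as the certificate it uses.
  opaque
    window-classified : ∀ {K r} → InducedPath∞ K r → ∀ w → 7 ℕ.+ w ℕ.≤ K →
      Ascending (windowAt r w) ⊎ Descending (windowAt r w)
    window-classified {r = r} p w 7+w≤K =
      subst (λ σ → Ascending σ ⊎ Descending σ)
        (signature-translate (- coord (r w)) (r w) (r (1 ℕ.+ w)) (r (2 ℕ.+ w)) (r (3 ℕ.+ w))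
                             (r (4 ℕ.+ w)) (r (5 ℕ.+ w)) (r (6 ℕ.+ w)))
        (All.lookup seven-vertex-windows-classified (prefix∈inducedPathsAtOrigin 6 (subpath w 7+w≤K p)))

  Clash : List Vertex∞ → List Vertex∞ → Set
  Clash xs ys = Any (λ x → Any (λ y → x ≡ y ⊎ Adj∞ y x) ys) xs

  clash? : ∀ xs ys → Dec (Clash xs ys)
  clash? xs ys = any? (λ x → any? (λ y → x ≟∞ y ⊎-dec adj? y x) ys) xs

  opaque
    rising-shapes-clash : All (λ xs → All (Clash xs) risingShapes) risingShapes
    rising-shapes-clash = by-evaluation (all? (λ xs → all? (clash? xs) risingShapes) risingShapes) refl

  opaque
    start-bounds≤2 : All (λ entry → proj₂ entry ≤ + 2) startBounds
    start-bounds≤2 = by-evaluation (all? (λ entry → proj₂ entry ℤₚ.≤? + 2) startBounds) refl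

  opaque
    end-bounds≤4 : All (λ entry → proj₂ entry ≤ + 4) endBounds
    end-bounds≤4 = by-evaluation (all? (λ entry → proj₂ entry ℤₚ.≤? + 4) endBounds) refl

  junctionOffsets : List ℤ
  junctionOffsets = -[1+ 0 ] ∷ + 0 ∷ + 1 ∷ + 2 ∷ []

  Junction : List Vertex∞ × ℤ → List Vertex∞ × ℤ → ℤ → Set
  Junction (xs , s) (ys , e) E = + 3 * E ≤ + 2 + s + e → Clash (map (translate E) xs) ys

  opaque
    junctions-clash : All (λ start → All (λ end → All (Junction start end) junctionOffsets) endBounds) startBounds
    junctions-clash = by-evaluation
      (all? (λ start → all? (λ end → all? (junction? start end) junctionOffsets) endBounds) startBounds) refl
      where
      junction? : ∀ start end E → Dec (Junction start end E)
      junction? (xs , s) (ys , e) E = + 3 * E ℤₚ.≤? + 2 + s + e →-dec clash? (map (translate E) xs) ys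

  opaque
    six-vertex-paths-clash : All (λ q → Clash (map (translate (+ 4)) q) q) (inducedPathsAtOrigin 5)
    six-vertex-paths-clash = by-evaluation (all? (λ q → clash? (map (translate (+ 4)) q) q) (inducedPathsAtOrigin 5)) refl

module ApartPaths where
  open ℤ using (ℤ; _+_; _-_; -_; _*_; _≤_)
  open Sequences
  open Cover
  open Windows

  AllAscending : ℕ → (ℕ → Vertex∞) → Set
  AllAscending k r = ∀ w → w ℕ.≤ k → Ascending (windowAt r w)

  AllDescending : ℕ → (ℕ → Vertex∞) → Set
  AllDescending k r = ∀ w → w ℕ.≤ k → Descending (windowAt r w)

  up-not-falling : ∀ {d} → d ≡ + 1 → ¬ Falling d
  up-not-falling refl (inj₁ ())
  up-not-falling refl (inj₂ ())

  down-not-rising : ∀ {d} → d ≡ -[1+ 0 ] → ¬ Rising d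
  down-not-rising refl (inj₁ ())
  down-not-rising refl (inj₂ ())

  ascending-then-descending : ∀ r w → Ascending (windowAt r w) → ¬ Descending (windowAt r (suc w))
  ascending-then-descending r w asc desc with Ascending.climbs asc
  ... | inj₁ up        = up-not-falling up (Descending.falling₁ desc)
  ... | inj₂ (inj₁ up) = up-not-falling up (Descending.falling₂ desc)
  ... | inj₂ (inj₂ up) = up-not-falling up (Descending.falling₃ desc)

  descending-then-ascending : ∀ r w → Descending (windowAt r w) → ¬ Ascending (windowAt r (suc w))
  descending-then-ascending r w desc asc with Descending.descends desc
  ... | inj₁ down        = down-not-rising down (Ascending.rising₁ asc)
  ... | inj₂ (inj₁ down) = down-not-rising down (Ascending.rising₂ asc)
  ... | inj₂ (inj₂ down) = down-not-rising down (Ascending.rising₃ asc)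

  windows-agree : ∀ {k r} → InducedPath∞ (7 ℕ.+ k) r → AllAscending k r ⊎ AllDescending k r
  windows-agree {k} {r} p with window-classified p 0 (ℕₚ.+-monoʳ-≤ 7 z≤n)
  ... | inj₁ asc₀  = inj₁ (all-ascending asc₀)
    where
    all-ascending : Ascending (windowAt r 0) → AllAscending k r
    all-ascending asc₀ zero _ = asc₀
    all-ascending asc₀ (suc w) w<k with window-classified p (suc w) (ℕₚ.+-monoʳ-≤ 7 w<k)
    ... | inj₁ asc  = asc
    ... | inj₂ desc = ⊥-elim (ascending-then-descending r w (all-ascending asc₀ w (ℕₚ.<⇒≤ w<k)) desc)
  ... | inj₂ desc₀ = inj₂ (all-descending desc₀)
    where
    all-descending : Descending (windowAt r 0) → AllDescending k r
    all-descending desc₀ zero _ = desc₀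
    all-descending desc₀ (suc w) w<k with window-classified p (suc w) (ℕₚ.+-monoʳ-≤ 7 w<k)
    ... | inj₁ asc  = ⊥-elim (descending-then-ascending r w (all-descending desc₀ w (ℕₚ.<⇒≤ w<k)) asc)
    ... | inj₂ desc = desc

  negated-falling : ∀ {d} → Falling d → - d ≢ -[1+ 0 ]
  negated-falling (inj₁ refl) ()
  negated-falling (inj₂ refl) ()

  falling-reversed : ∀ u v → Falling (step u v) → step v u ≢ -[1+ 0 ]
  falling-reversed u v falling down = negated-falling falling (trans (sym (step-reverse u v)) down)

  orient : ∀ {k r} → InducedPath∞ (7 ℕ.+ k) r → AllAscending k r ⊎ AllAscending k (reversed (6 ℕ.+ k) r)
  orient {k} {r} p with windows-agree p
  ... | inj₁ asc = inj₁ asc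
  ... | inj₂ desc with windows-agree (reverse-path (6 ℕ.+ k) p)
  ...   | inj₁ asc′  = inj₂ asc′
  ...   | inj₂ desc′ = ⊥-elim (both-descending (Descending.descends (desc′ 0 z≤n)))
    where
    open Descending (desc k ℕₚ.≤-refl)
    both-descending : step (r (4 ℕ.+ k)) (r (3 ℕ.+ k)) ≡ -[1+ 0 ] ⊎ step (r (3 ℕ.+ k)) (r (2 ℕ.+ k)) ≡ -[1+ 0 ]
                      ⊎ step (r (2 ℕ.+ k)) (r (1 ℕ.+ k)) ≡ -[1+ 0 ] → ⊥
    both-descending (inj₁ down)        = falling-reversed (r (3 ℕ.+ k)) (r (4 ℕ.+ k)) falling₃ down
    both-descending (inj₂ (inj₁ down)) = falling-reversed (r (2 ℕ.+ k)) (r (3 ℕ.+ k)) falling₂ down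
    both-descending (inj₂ (inj₂ down)) = falling-reversed (r (1 ℕ.+ k)) (r (2 ℕ.+ k)) falling₁ down

  cost≤debt-change : ∀ {t₁ t₂ t₃} → Rising t₁ → Rising t₂ → Rising t₃ →
    (t₃ ≡ + 0 → t₁ ≡ + 1 × t₂ ≡ + 1) → cost t₃ + debt t₁ t₂ ≤ debt t₂ t₃
  cost≤debt-change _ _ (inj₁ refl) after-rises with after-rises refl
  ... | refl , refl = ℤₚ.≤-refl
  cost≤debt-change (inj₁ refl) (inj₁ refl) (inj₂ refl) _ = ℤₚ.≤-refl
  cost≤debt-change (inj₂ refl) (inj₁ refl) (inj₂ refl) _ = ℤₚ.≤-refl
  cost≤debt-change (inj₁ refl) (inj₂ refl) (inj₂ refl) _ = ℤₚ.≤-refl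
  cost≤debt-change (inj₂ refl) (inj₂ refl) (inj₂ refl) _ = -≤+

  levelAt : (ℕ → Vertex∞) → ℕ → ℤ
  levelAt r i = level (r i)

  stepAt : (ℕ → Vertex∞) → ℕ → ℤ
  stepAt r i = step (r i) (r (suc i))

  shapeAt : (ℕ → Vertex∞) → ℕ → List Vertex∞
  shapeAt r i = shape (r i) (r (suc i)) (r (suc (suc i)))

  window-position : ∀ k d i → i ℕ.≤ d ℕ.+ k → i ℕ.≤ k ⊎ ∃ λ p → p ℕ.< d × i ≡ suc p ℕ.+ k
  window-position k d i i≤d+k with i ℕ.≤? k
  ... | yes i≤k = inj₁ i≤k
  ... | no  i≰k = inj₂ (i ℕ.∸ suc k , ℕₚ.+-cancelʳ-≤ k _ _ (subst (ℕ._≤ d ℕ.+ k) i≡ i≤d+k) , i≡)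
    where
    i≡ : i ≡ suc (i ℕ.∸ suc k) ℕ.+ k
    i≡ = sym (trans (sym (ℕₚ.+-suc (i ℕ.∸ suc k) k)) (ℕₚ.m∸n+n≡m (ℕₚ.≰⇒> i≰k)))

  ascending-rising : ∀ {k r} → AllAscending k r → ∀ i → i ℕ.≤ 3 ℕ.+ k → Rising (stepAt r (suc i))
  ascending-rising {k} asc i i≤3+k with window-position k 3 i i≤3+k
  ... | inj₁ i≤k = Ascending.rising₁ (asc i i≤k)
  ... | inj₂ (0 , _ , refl) = Ascending.rising₂ (asc k ℕₚ.≤-refl)
  ... | inj₂ (1 , _ , refl) = Ascending.rising₃ (asc k ℕₚ.≤-refl)
  ... | inj₂ (2 , _ , refl) = Ascending.rising₄ (asc k ℕₚ.≤-refl)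
  ... | inj₂ (suc (suc (suc _)) , s≤s (s≤s (s≤s ())) , _)

  ascending-shape : ∀ {k r} → AllAscending k r → ∀ i → i ℕ.≤ 4 ℕ.+ k → shapeAt r i ∈ risingShapes
  ascending-shape {k} asc i i≤4+k with window-position k 4 i i≤4+k
  ... | inj₁ i≤k = Ascending.shape₀-rising (asc i i≤k)
  ... | inj₂ (0 , _ , refl) = Ascending.shape₁-rising (asc k ℕₚ.≤-refl)
  ... | inj₂ (1 , _ , refl) = Ascending.shape₂-rising (asc k ℕₚ.≤-refl)
  ... | inj₂ (2 , _ , refl) = Ascending.shape₃-rising (asc k ℕₚ.≤-refl)
  ... | inj₂ (3 , _ , refl) = Ascending.shape₄-rising (asc k ℕₚ.≤-refl)
  ... | inj₂ (suc (suc (suc (suc _))) , s≤s (s≤s (s≤s (s≤s ()))) , _)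

  potential : (ℕ → Vertex∞) → ℕ → ℤ
  potential r w = + 2 * + (3 ℕ.+ w) - + 3 * levelAt r (3 ℕ.+ w) - debt (stepAt r (1 ℕ.+ w)) (stepAt r (2 ℕ.+ w))

  potential-nonincreasing : ∀ r w → Ascending (windowAt r w) → potential r (suc w) ≤ potential r w
  potential-nonincreasing r w asc = begin
    potential r (suc w)                               ≡⟨ cong (λ m → + 2 * m - + 3 * ℓ₄ - c₂) (ℤₚ.pos-+ 1 (3 ℕ.+ w)) ⟩
    + 2 * (+ 1 + + (3 ℕ.+ w)) - + 3 * ℓ₄ - c₂          ≡⟨ rearrange (+ (3 ℕ.+ w)) ℓ₃ ℓ₄ c₁ c₂ ⟩
    potential r w + (cost (ℓ₄ - ℓ₃) + c₁) - c₂         ≤⟨ ℤₚ.+-monoˡ-≤ (- c₂) (ℤₚ.+-monoʳ-≤ (potential r w) covered) ⟩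
    potential r w + c₂ - c₂                           ≡⟨ cancel (potential r w) c₂ ⟩
    potential r w                                     ∎
    where
    open ℤₚ.≤-Reasoning
    open Ascending asc
    ℓ₃ ℓ₄ c₁ c₂ : ℤ
    ℓ₃ = levelAt r (3 ℕ.+ w)
    ℓ₄ = levelAt r (4 ℕ.+ w)
    c₁ = debt (stepAt r (1 ℕ.+ w)) (stepAt r (2 ℕ.+ w))
    c₂ = debt (stepAt r (2 ℕ.+ w)) (stepAt r (3 ℕ.+ w))
    covered : cost (ℓ₄ - ℓ₃) + c₁ ≤ c₂
    covered = cost≤debt-change rising₁ rising₂ rising₃ flat-after-two-rises
    rearrange : ∀ m ℓ₃ ℓ₄ c₁ c₂ →
      + 2 * (+ 1 + m) - + 3 * ℓ₄ - c₂ ≡ (+ 2 * m - + 3 * ℓ₃ - c₁) + ((+ 2 - + 3 * (ℓ₄ - ℓ₃)) + c₁) - c₂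
    rearrange = solve-∀
    cancel : ∀ x c → x + c - c ≡ x
    cancel = solve-∀

  start-potential : ∀ r → potential r 1 + + 3 * levelAt r 0 ≡ startPotential (windowAt r 0)
  start-potential r = telescope (levelAt r 0) (levelAt r 1) (levelAt r 2) (levelAt r 3) (levelAt r 4)
                                (debt (stepAt r 2) (stepAt r 3))
    where
    telescope : ∀ ℓ₀ ℓ₁ ℓ₂ ℓ₃ ℓ₄ c → + 2 * + 4 - + 3 * ℓ₄ - c + + 3 * ℓ₀ ≡
      (+ 2 - + 3 * (ℓ₁ - ℓ₀)) + (+ 2 - + 3 * (ℓ₂ - ℓ₁)) + (+ 2 - + 3 * (ℓ₃ - ℓ₂)) + (+ 2 - + 3 * (ℓ₄ - ℓ₃)) - c
    telescope = solve-∀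

  end-potential : ∀ r k →
    + 2 * + (6 ℕ.+ k) - + 3 * levelAt r (6 ℕ.+ k) ≡ potential r (suc k) + endPotential (windowAt r k)
  end-potential r k = trans (cong (λ m → + 2 * m - + 3 * levelAt r (6 ℕ.+ k)) (ℤₚ.pos-+ 2 (4 ℕ.+ k)))
    (telescope (+ (4 ℕ.+ k)) (levelAt r (4 ℕ.+ k)) (levelAt r (5 ℕ.+ k)) (levelAt r (6 ℕ.+ k))
               (debt (stepAt r (2 ℕ.+ k)) (stepAt r (3 ℕ.+ k))))
    where
    telescope : ∀ m ℓ₄ ℓ₅ ℓ₆ c → + 2 * (+ 2 + m) - + 3 * ℓ₆ ≡
      (+ 2 * m - + 3 * ℓ₄ - c) + (c + (+ 2 - + 3 * (ℓ₅ - ℓ₄)) + (+ 2 - + 3 * (ℓ₆ - ℓ₅)))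
    telescope = solve-∀

  ascending-potential-bound : ∀ {k r} → AllAscending k r →
    + 2 * + (6 ℕ.+ k) - + 3 * (levelAt r (6 ℕ.+ k) - levelAt r 0)
      ≤ startPotential (windowAt r 0) + endPotential (windowAt r k)
  ascending-potential-bound {k} {r} asc = begin
    + 2 * + (6 ℕ.+ k) - + 3 * (levelAt r (6 ℕ.+ k) - ℓ₀)       ≡⟨ separate (+ 2 * + (6 ℕ.+ k)) (levelAt r (6 ℕ.+ k)) ℓ₀ ⟩
    (+ 2 * + (6 ℕ.+ k) - + 3 * levelAt r (6 ℕ.+ k)) + + 3 * ℓ₀  ≡⟨ cong (_+ + 3 * ℓ₀) (end-potential r k) ⟩
    potential r (suc k) + ending + + 3 * ℓ₀                     ≤⟨ ℤₚ.+-monoˡ-≤ (+ 3 * ℓ₀) (ℤₚ.+-monoˡ-≤ ending decreased) ⟩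
    potential r 1 + ending + + 3 * ℓ₀                           ≡⟨ swap (potential r 1) ending (+ 3 * ℓ₀) ⟩
    (potential r 1 + + 3 * ℓ₀) + ending                         ≡⟨ cong (_+ ending) (start-potential r) ⟩
    startPotential (windowAt r 0) + ending                      ∎
    where
    open ℤₚ.≤-Reasoning
    ℓ₀ ending : ℤ
    ℓ₀ = levelAt r 0
    ending = endPotential (windowAt r k)
    decreased : potential r (suc k) ≤ potential r 1
    decreased = descent (potential r ∘ suc) k (λ i i<k → potential-nonincreasing r (suc i) (asc (suc i) i<k))
    separate : ∀ a ℓ ℓ₀ → a - + 3 * (ℓ - ℓ₀) ≡ (a - + 3 * ℓ) + + 3 * ℓ₀
    separate = solve-∀
    swap : ∀ x y z → x + y + z ≡ (x + z) + y
    swap = solve-∀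

  OnPath : ℕ → (ℕ → Vertex∞) → List Vertex∞ → Set
  OnPath K r = All (λ x → ∃ λ i → i ℕ.< K × x ≡ r i)

  clash-translate⁻ : ∀ c xs ys → Clash (map (translate c) xs) (map (translate c) ys) → Clash xs ys
  clash-translate⁻ c xs ys clash = Any.map (λ hit → Any.map untranslate (map⁻ hit)) (map⁻ clash)
    where
    untranslate : ∀ {x y} → translate c x ≡ translate c y ⊎ Adj∞ (translate c y) (translate c x) → x ≡ y ⊎ Adj∞ y x
    untranslate (inj₁ eq)  = inj₁ (translate-injective c eq)
    untranslate (inj₂ adj) = inj₂ (Adj∞-translate⁻ c adj)

  apart-no-clash : ∀ {N K r xs ys} → Apart N K r → OnPath K r xs → OnPath K r ys → ¬ Clash (map (translate N) xs) ys
  apart-no-clash {N} apart xs-on ys-on clash =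
    All.lookupWith {R = λ _ → ⊥} (λ { (a , a<K , refl) hit →
      All.lookupWith {R = λ _ → ⊥} (λ { (b , b<K , refl) (inj₁ eq) → Apart.disjoint apart a b a<K b<K eq
                        ; (b , b<K , refl) (inj₂ adj) → Apart.anticomplete apart a b a<K b<K adj })
                     ys-on hit })
      xs-on (map⁻ clash)

  apart-no-translated-clash : ∀ {N K r xs ys} → Apart N K r → OnPath K r xs → OnPath K r ys →
    ∀ c → ¬ Clash (map (translate c) (map (translate N) xs)) (map (translate c) ys)
  apart-no-translated-clash apart xs-on ys-on c clash =
    apart-no-clash apart xs-on ys-on (clash-translate⁻ c _ _ clash)

  excess-trichotomy : ∀ E → E ≤ -[1+ 1 ] ⊎ E ∈ junctionOffsets ⊎ + 3 ≤ E
  excess-trichotomy (+ 0)                   = inj₂ (inj₁ (there (here refl)))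
  excess-trichotomy (+ 1)                   = inj₂ (inj₁ (there (there (here refl))))
  excess-trichotomy (+ 2)                   = inj₂ (inj₁ (there (there (there (here refl)))))
  excess-trichotomy (+ suc (suc (suc _)))   = inj₂ (inj₂ (+≤+ (s≤s (s≤s (s≤s z≤n)))))
  excess-trichotomy -[1+ 0 ]                = inj₂ (inj₁ (here refl))
  excess-trichotomy -[1+ suc _ ]            = inj₁ (-≤- (s≤s z≤n))

  bounded-entry : ∀ {key value table} → Bounded key value table → ∃ λ b → (key , b) ∈ table × value ≤ b
  bounded-entry bounded with find bounded
  ... | _ , entry∈ , refl , value≤b = _ , entry∈ , value≤b

  module _ {k N : ℕ} {r : ℕ → Vertex∞} (balanced : 3 ℕ.* N ≡ 2 ℕ.* (7 ℕ.+ k))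
           (p : InducedPath∞ (7 ℕ.+ k) r) (apart : Apart (+ N) (7 ℕ.+ k) r) (asc : AllAscending k r) where

    private
      ℓ : ℕ → ℤ
      ℓ = levelAt r

      excess : ℤ
      excess = ℓ 0 + + N - ℓ (6 ℕ.+ k)

      start-entry : ∃ λ b → (Signature.head (windowAt r 0) , b) ∈ startBounds × startPotential (windowAt r 0) ≤ b
      start-entry = bounded-entry (Ascending.start-bounded (asc 0 z≤n))

      end-entry : ∃ λ b → (Signature.tail (windowAt r k) , b) ∈ endBounds × endPotential (windowAt r k) ≤ b
      end-entry = bounded-entry (Ascending.end-bounded (asc k ℕₚ.≤-refl))

      vs ve : ℤ
      vs = proj₁ start-entry
      ve = proj₁ end-entry

      three-N : + 3 * + N ≡ + 2 * (+ 1 + + (6 ℕ.+ k))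
      three-N = begin
        + 3 * + N                 ≡⟨ ℤₚ.pos-* 3 N ⟨
        + (3 ℕ.* N)               ≡⟨ cong +_ balanced ⟩
        + (2 ℕ.* (7 ℕ.+ k))       ≡⟨ ℤₚ.pos-* 2 (7 ℕ.+ k) ⟩
        + 2 * + (7 ℕ.+ k)         ≡⟨ cong (+ 2 *_) (ℤₚ.pos-+ 1 (6 ℕ.+ k)) ⟩
        + 2 * (+ 1 + + (6 ℕ.+ k)) ∎
        where open ≡-Reasoning

      excess-bound : + 3 * excess - + 2 ≤ vs + ve
      excess-bound = begin
        + 3 * excess - + 2                                         ≡⟨ expand (ℓ 0) (+ N) (ℓ (6 ℕ.+ k)) ⟩
        + 3 * + N + (+ 3 * ℓ 0 - + 3 * ℓ (6 ℕ.+ k) - + 2)            ≡⟨ cong (_+ (+ 3 * ℓ 0 - + 3 * ℓ (6 ℕ.+ k) - + 2)) three-N ⟩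
        + 2 * (+ 1 + + (6 ℕ.+ k)) + (+ 3 * ℓ 0 - + 3 * ℓ (6 ℕ.+ k) - + 2) ≡⟨ collect (+ (6 ℕ.+ k)) (ℓ 0) (ℓ (6 ℕ.+ k)) ⟩
        + 2 * + (6 ℕ.+ k) - + 3 * (ℓ (6 ℕ.+ k) - ℓ 0)                ≤⟨ ascending-potential-bound {k} {r} asc ⟩
        startPotential (windowAt r 0) + endPotential (windowAt r k)
                                                                   ≤⟨ ℤₚ.+-mono-≤ (proj₂ (proj₂ start-entry)) (proj₂ (proj₂ end-entry)) ⟩
        vs + ve                                                    ∎
        where
        open ℤₚ.≤-Reasoning
        expand : ∀ a n b → + 3 * (a + n - b) - + 2 ≡ + 3 * n + (+ 3 * a - + 3 * b - + 2)
        expand = solve-∀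
        collect : ∀ m a b → + 2 * (+ 1 + m) + (+ 3 * a - + 3 * b - + 2) ≡ + 2 * m - + 3 * (b - a)
        collect = solve-∀

      on-path : ∀ i → i ℕ.≤ 6 ℕ.+ k → ∃ λ j → j ℕ.< 7 ℕ.+ k × r i ≡ r j
      on-path i i≤6+k = i , s≤s i≤6+k , refl

      large-excess : + 3 ≤ excess → ⊥
      large-excess 3≤excess = seven≰six (begin
        + 7                            ≤⟨ ℤₚ.+-monoˡ-≤ (- + 2) (ℤₚ.+-mono-≤ (ℤₚ.+-mono-≤ 3≤excess 3≤excess) 3≤excess) ⟩
        excess + excess + excess - + 2 ≡⟨ triple excess ⟩
        + 3 * excess - + 2             ≤⟨ excess-bound ⟩
        vs + ve                        ≤⟨ ℤₚ.+-mono-≤ (All.lookup start-bounds≤2 (proj₁ (proj₂ start-entry)))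
                                                      (All.lookup end-bounds≤4 (proj₁ (proj₂ end-entry))) ⟩
        + 6                            ∎)
        where
        open ℤₚ.≤-Reasoning
        triple : ∀ e → e + e + e - + 2 ≡ + 3 * e - + 2
        triple = solve-∀
        seven≰six : ¬ (+ 7 ≤ + 6)
        seven≰six (+≤+ (s≤s (s≤s (s≤s (s≤s (s≤s (s≤s ())))))))

      moderate-excess : excess ∈ junctionOffsets → ⊥
      moderate-excess excess∈ =
        apart-no-translated-clash apart
          (on-path 0 z≤n ∷ on-path 1 (s≤s z≤n) ∷ [])
          (on-path (4 ℕ.+ k) (ℕₚ.m≤n+m _ 2) ∷ on-path (5 ℕ.+ k) (ℕₚ.m≤n+m _ 1) ∷ on-path (6 ℕ.+ k) ℕₚ.≤-refl ∷ [])
          (- ℓ (6 ℕ.+ k)) (subst (λ xs → Clash xs tail) joined clash)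
        where
        tail : List Vertex∞
        tail = normalizeAt (r (6 ℕ.+ k)) (r (4 ℕ.+ k) ∷ r (5 ℕ.+ k) ∷ r (6 ℕ.+ k) ∷ [])
        fits : + 3 * excess ≤ + 2 + vs + ve
        fits = ℤₚ.≤-trans (ℤₚ.≤-reflexive (add-two (+ 3 * excess)))
                 (ℤₚ.≤-trans (ℤₚ.+-monoˡ-≤ (+ 2) excess-bound) (ℤₚ.≤-reflexive (rotate vs ve)))
          where
          add-two : ∀ x → x ≡ (x - + 2) + + 2
          add-two = solve-∀
          rotate : ∀ a b → (a + b) + + 2 ≡ + 2 + a + b
          rotate = solve-∀
        clash : Clash (map (translate excess) (normalizeAt (r 0) (r 0 ∷ r 1 ∷ []))) tail
        clash = All.lookup (All.lookup (All.lookup junctions-clash (proj₁ (proj₂ start-entry)))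
                                       (proj₁ (proj₂ end-entry))) excess∈ fits
        joined : map (translate excess) (normalizeAt (r 0) (r 0 ∷ r 1 ∷ []))
               ≡ map (translate (- ℓ (6 ℕ.+ k))) (map (translate (+ N)) (r 0 ∷ r 1 ∷ []))
        joined = trans (map-translate-translate excess (- ℓ 0) (r 0 ∷ r 1 ∷ []))
          (trans (cong (λ c → map (translate c) (r 0 ∷ r 1 ∷ [])) (offsets (ℓ 0) (+ N) (ℓ (6 ℕ.+ k))))
                 (sym (map-translate-translate (- ℓ (6 ℕ.+ k)) (+ N) (r 0 ∷ r 1 ∷ []))))
          where
          offsets : ∀ a n b → - a + (a + n - b) ≡ n + - b
          offsets = solve-∀

      overshoot : excess ≤ -[1+ 1 ] → ℓ 1 + + N ≤ ℓ (5 ℕ.+ k)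
      overshoot excess≤-2 = begin
        ℓ 1 + + N                              ≤⟨ ℤₚ.+-monoˡ-≤ (+ N) (unit-step-bound 0 (s≤s (s≤s z≤n))) ⟩
        (+ 1 + ℓ 0) + + N                      ≡⟨ regroup (ℓ 0) (+ N) (ℓ (6 ℕ.+ k)) ⟩
        excess + (ℓ (6 ℕ.+ k) + + 1)           ≤⟨ ℤₚ.+-monoˡ-≤ (ℓ (6 ℕ.+ k) + + 1) excess≤-2 ⟩
        -[1+ 1 ] + (ℓ (6 ℕ.+ k) + + 1)
                    ≤⟨ ℤₚ.+-monoʳ-≤ -[1+ 1 ] (ℤₚ.+-monoˡ-≤ (+ 1) (unit-step-bound (5 ℕ.+ k) ℕₚ.≤-refl)) ⟩
        -[1+ 1 ] + ((+ 1 + ℓ (5 ℕ.+ k)) + + 1) ≡⟨ cancel (ℓ (5 ℕ.+ k)) ⟩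
        ℓ (5 ℕ.+ k)                            ∎
        where
        open ℤₚ.≤-Reasoning
        unit-step-bound : ∀ i → suc i ℕ.< 7 ℕ.+ k → ℓ (suc i) ≤ + 1 + ℓ i
        unit-step-bound i i+1<K = difference-≤ {ℓ i} {ℓ (suc i)}
          (unit-step≤1 (Adj∞⇒unit-step (InducedPath∞.adjacent p i i+1<K)))
        regroup : ∀ a n b → (+ 1 + a) + n ≡ (a + n - b) + (b + + 1)
        regroup = solve-∀
        cancel : ∀ x → -[1+ 1 ] + ((+ 1 + x) + + 1) ≡ x
        cancel = solve-∀

      negative-excess : excess ≤ -[1+ 1 ] → ⊥
      negative-excess excess≤-2 with intermediate-value (ℓ ∘ suc) (4 ℕ.+ k) slow lo (overshoot excess≤-2)
        where
        slow : ∀ i → i ℕ.< 4 ℕ.+ k → ℓ (suc (suc i)) ≤ + 1 + ℓ (suc i)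
        slow i i<4+k = difference-≤ (rising≤1 (ascending-rising {k} {r} asc i (ℕₚ.≤-pred i<4+k)))
        lo : ℓ 1 ≤ ℓ 1 + + N
        lo = ℤₚ.≤-trans (ℤₚ.≤-reflexive (sym (ℤₚ.+-identityʳ (ℓ 1)))) (ℤₚ.+-monoʳ-≤ (ℓ 1) (+≤+ z≤n))
      ... | j , j≤4+k , ℓ[1+j]≡ =
        apart-no-translated-clash apart
          (on-path 0 z≤n ∷ on-path 1 (s≤s z≤n) ∷ on-path 2 (s≤s (s≤s z≤n)) ∷ [])
          (on-path j (ℕₚ.m≤n⇒m≤o+n 2 j≤4+k) ∷ on-path (suc j) (ℕₚ.m≤n⇒m≤o+n 1 (s≤s j≤4+k))
            ∷ on-path (suc (suc j)) (s≤s (s≤s j≤4+k)) ∷ [])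
          (- ℓ (suc j)) (subst (λ xs → Clash xs (shapeAt r j)) first-shape clash)
        where
        clash : Clash (shapeAt r 0) (shapeAt r j)
        clash = All.lookup (All.lookup rising-shapes-clash (ascending-shape {k} {r} asc 0 z≤n))
                           (ascending-shape {k} {r} asc j j≤4+k)
        first-shape : shapeAt r 0 ≡ map (translate (- ℓ (suc j))) (map (translate (+ N)) (r 0 ∷ r 1 ∷ r 2 ∷ []))
        first-shape = trans (sym (shape-translate (+ N) (r 0) (r 1) (r 2)))
          (cong (λ ℓ′ → map (translate (- ℓ′)) (map (translate (+ N)) (r 0 ∷ r 1 ∷ r 2 ∷ [])))
                (trans (level-translate (+ N) (r 1)) (sym ℓ[1+j]≡)))

    no-ascending-apart-path : ⊥
    no-ascending-apart-path with excess-trichotomy excess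
    ... | inj₁ negative        = negative-excess negative
    ... | inj₂ (inj₁ moderate) = moderate-excess moderate
    ... | inj₂ (inj₂ large)    = large-excess large

  no-apart-path : ∀ k N {r} → 3 ℕ.* N ≡ 2 ℕ.* (7 ℕ.+ k) → InducedPath∞ (7 ℕ.+ k) r → ¬ Apart (+ N) (7 ℕ.+ k) r
  no-apart-path k N balanced p apart with orient p
  ... | inj₁ asc = no-ascending-apart-path balanced p apart asc
  ... | inj₂ asc = no-ascending-apart-path balanced (reverse-path (6 ℕ.+ k) p) (reverse-apart (6 ℕ.+ k) apart) asc

  no-apart-six-vertex-path : ∀ {r} → InducedPath∞ 6 r → ¬ Apart (+ 4) 6 r
  no-apart-six-vertex-path {r} p apart =
    apart-no-translated-clash apart on-path on-path c
      (subst (λ xs → Clash xs (map (translate c) (prefix r 5))) commute clash)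
    where
    c : ℤ
    c = - coord (r 0)
    clash : Clash (map (translate (+ 4)) (map (translate c) (prefix r 5))) (map (translate c) (prefix r 5))
    clash = All.lookup six-vertex-paths-clash (prefix∈inducedPathsAtOrigin 5 p)
    commute : map (translate (+ 4)) (map (translate c) (prefix r 5)) ≡ map (translate c) (map (translate (+ 4)) (prefix r 5))
    commute = trans (map-translate-translate (+ 4) c (prefix r 5))
      (trans (cong (λ e → map (translate e) (prefix r 5)) (ℤₚ.+-comm c (+ 4)))
             (sym (map-translate-translate c (+ 4) (prefix r 5))))
    on-path : OnPath 6 r (prefix r 5)
    on-path = All.tabulate λ x∈ → let i , i≤5 , eq = ∈-prefix {r} {5} x∈ in i , s≤s i≤5 , eq

  no-apart-path-of-length-3n : ∀ m {r} →
    InducedPath∞ (3 ℕ.* (2 ℕ.+ m)) r → ¬ Apart (+ (2 ℕ.* (2 ℕ.+ m))) (3 ℕ.* (2 ℕ.+ m)) r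
  no-apart-path-of-length-3n zero    p apart = no-apart-six-vertex-path p apart
  no-apart-path-of-length-3n (suc m) {r} p apart =
    no-apart-path (2 ℕ.+ 3 ℕ.* m) (2 ℕ.* (3 ℕ.+ m)) (balanced m)
      (subst (λ K → InducedPath∞ K r) (length≡ m) p)
      (subst (λ K → Apart (+ (2 ℕ.* (3 ℕ.+ m))) K r) (length≡ m) apart)
    where
    length≡ : ∀ m → 3 ℕ.* (3 ℕ.+ m) ≡ 7 ℕ.+ (2 ℕ.+ 3 ℕ.* m)
    length≡ = ℕ-Solver.solve-∀
    balanced : ∀ m → 3 ℕ.* (2 ℕ.* (3 ℕ.+ m)) ≡ 2 ℕ.* (7 ℕ.+ (2 ℕ.+ 3 ℕ.* m))
    balanced = ℕ-Solver.solve-∀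

open ApartPaths using (no-apart-path-of-length-3n)
open Zigzag using (long-induced-path)
open import Data.Nat using (_≤_; _*_; _∸_)

no-long-induced-path : ∀ n → 2 ≤ n → ¬ InducedPath n (3 * n)
no-long-induced-path (suc (suc m)) _ path =
  no-apart-path-of-length-3n m (lifted-path path) (lifted-apart path (s≤s z≤n))
  where open Projection (suc m)
no-long-induced-path (suc zero) (s≤s ())

proposition2p5 : (n : ℕ) → 2 ≤ n →
    InducedPath n (3 * n ∸ 1) × ¬ InducedPath n (3 * n)
proposition2p5 n@(suc m) 2≤n = long-induced-path m , no-long-induced-path n 2≤n
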